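{- Let $m,n$ be positive integers with $m\leq n$ and fix $0\le k\le n-1$ and $0\le \ell\le n-1$. Then \[ |\mathrm{PF}_{m,n}(k,\ell)|=\sum_{i=1}^n\left[X(i)+Y(i)+\sum_{x=0}^{m-1}\left(Z(i,x)+\sum_{R=1}^{n-i-1}V(i,x,R)+\sum_{R=k+1}^{i-2}W(i,x,R)\right)\right], \] where $X(i)=\binom{m-1}{n-i}|\mathrm{PF}_{m-1-n+i,\,i-1}(k,\ell)|\,|\mathrm{C}_{n-i,n-i}(k,\ell)|\,\min(k,n-i)$, $Y(i)=\binom{m-1}{i-1}|\mathrm{PF}_{i-1,i-1}(k,\ell)|\,|\mathrm{C}_{m-i,n-i}(k,\ell)|\,\min(i-1,\ell)$, $Z(i,x)=\binom{m-1}{x}|\mathrm{PF}_{x,i-1}(k,\ell)|\,|\mathrm{C}_{m-1-x,n-i}(k,\ell)|$, $V(i,x,R)=\binom{m-1}{x}|\mathrm{PF}_{x,i-1}(k,\ell)|\binom{m-1-x}{R}|\mathrm{C}_{R,R}(k,\ell)|\,|\mathrm{C}_{m-1-x-R,\,n-R-i-1}(k,\ell)|\,\min(R,k)$, and $W(i,x,R)=\binom{m-1}{x}|\mathrm{PF}_{x,i-R-2}(k,\ell)|\binom{m-1-x}{R}|\mathrm{C}_{R,R}(k,\ell)|\,|\mathrm{C}_{m-1-x-R,\,n-i}(k,\ell)|\,\min(R-k,\ell)$.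
   Context: $(k,\ell)$-pullback parking rule (for a street with spots $1,\dots,b$ and $a$ cars, $k,\ell\ge 0$): given $\alpha=(a_1,\dots,a_a)\in[b]^a$, cars enter in order $1,2,\dots$; car $j$ drives to spot $a_j$ and parks there if empty; otherwise it checks spots $a_j-1,\dots,a_j-k$ in order (stopping at the start of the street) and parks in the first empty one; if none, it checks spots $a_j+1,\dots,a_j+\ell$ in order (not beyond the end of the street) and parks in the first empty one; otherwise it fails. $\mathrm{PF}_{a,b}(k,\ell)$ is the set of $\alpha\in[b]^a$ for which all cars park. Contained pullback parking functions: $\mathrm{C}_{a,b}(k,\ell)$ is the set of $\alpha\in \mathrm{PF}_{a,b}(k,\ell)$ such that, when an additional empty spot $0$ is placed before spot $1$ and the cars park by the same rule on the street with spots $0,1,\dots,b$ (so a car backing up may enter spot $0$), all cars park in spots $1,\dots,b$ and no car backs into spot $0$. Conventions: $|\mathrm{PF}_{a,b}(k,\ell)|=0$ (hence $|\mathrm{C}_{a,b}(k,\ell)|=0$) whenever $a>b$; binomial coefficients $\binom{p}{q}$ are $0$ when $q>p$ or $q<0$; empty sums are $0$; the empty preference list (zero cars) counts as one parking function. -}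

module Defs where

open import Data.Nat using (ℕ; zero; suc; _+_; _*_; _∸_; _⊓_; _≤ᵇ_; _≡ᵇ_)
open import Data.Nat.Combinatorics using (_C_)
open import Data.Bool using (Bool; true; false; if_then_else_; _∧_; not)
open import Data.Maybe using (Maybe; just; nothing)
open import Data.List using (List; []; _∷_; _++_; map; concatMap; allFin; upTo)
open import Data.Nat.ListAction using (sum)
open import Data.Bool.ListAction using (any)
open import Data.Vec using (Vec; []; _∷_; toList)
open import Data.Fin using (Fin; toℕ)

occupied : ℕ → List ℕ → Bool
occupied s occ = any (λ t → s ≡ᵇ t) occ

back : ℕ → ℕ → ℕ → List ℕ
back lo a zero = []
back lo zero (suc k) = []
back lo (suc a) (suc k) = if lo ≤ᵇ a then a ∷ back lo a k else []

fwd : ℕ → ℕ → ℕ → List ℕ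
fwd b a zero = []
fwd b a (suc l) = if suc a ≤ᵇ b then suc a ∷ fwd b (suc a) l else []

firstFree : List ℕ → List ℕ → Maybe ℕ
firstFree occ [] = nothing
firstFree occ (s ∷ ss) = if occupied s occ then firstFree occ ss else just s

-- Run the (k,l)-pullback parking rule on a street with spots lo, ..., b,
-- starting with occupied spots occ, for the given preference list.
run : (lo b k l : ℕ) → List ℕ → List ℕ → Maybe (List ℕ)
run lo b k l occ [] = just occ
run lo b k l occ (a ∷ as) with firstFree occ (a ∷ back lo a k ++ fwd b a l)
... | nothing = nothing
... | just s = run lo b k l (s ∷ occ) as

-- A preference α ∈ [b]^a is a vector of Fin b; the entry j denotes spot toℕ j + 1.
prefs : ∀ {a b} → Vec (Fin b) a → List ℕ
prefs v = map (λ j → suc (toℕ j)) (toList v)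

isJust : ∀ {A : Set} → Maybe A → Bool
isJust (just _) = true
isJust nothing = false

isPF : (k l : ℕ) → ∀ {a b} → Vec (Fin b) a → Bool
isPF k l {a} {b} v = isJust (run 1 b k l [] (prefs v))

-- With an extra empty spot 0 in front: all cars park and none uses spot 0.
parksAvoiding0 : Maybe (List ℕ) → Bool
parksAvoiding0 nothing = false
parksAvoiding0 (just occ) = not (occupied 0 occ)

isC : (k l : ℕ) → ∀ {a b} → Vec (Fin b) a → Bool
isC k l {a} {b} v = isPF k l v ∧ parksAvoiding0 (run 0 b k l [] (prefs v))

allVecs : (a b : ℕ) → List (Vec (Fin b) a)
allVecs zero b = [] ∷ []
allVecs (suc a) b = concatMap (λ v → map (λ j → j ∷ v) (allFin b)) (allVecs a b)

countTrue : ∀ {A : Set} → (A → Bool) → List A → ℕ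
countTrue p [] = 0
countTrue p (x ∷ xs) = (if p x then 1 else 0) + countTrue p xs

numPF : (k l a b : ℕ) → ℕ
numPF k l a b = countTrue (isPF k l) (allVecs a b)

numC : (k l a b : ℕ) → ℕ
numC k l a b = countTrue (isC k l) (allVecs a b)

-- Σ_{i=lo}^{hi} f i  (0 if hi < lo)
sumFT : ℕ → ℕ → (ℕ → ℕ) → ℕ
sumFT lo hi f = sum (map (λ j → f (lo + j)) (upTo (suc hi ∸ lo)))

-- The summands of Theorem 3.14 (with truncated subtraction ∸; every
-- place where a true difference would be negative is multiplied by a
-- binomial coefficient that vanishes).
module Terms (m n k l : ℕ) where
  PF : ℕ → ℕ → ℕ
  PF = numPF k l
  Cc : ℕ → ℕ → ℕ
  Cc = numC k l

  X : ℕ → ℕ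
  X i = ((m ∸ 1) C (n ∸ i)) * PF ((m ∸ 1 + i) ∸ n) (i ∸ 1) * Cc (n ∸ i) (n ∸ i) * (k ⊓ (n ∸ i))

  Y : ℕ → ℕ
  Y i = ((m ∸ 1) C (i ∸ 1)) * PF (i ∸ 1) (i ∸ 1) * Cc (m ∸ i) (n ∸ i) * ((i ∸ 1) ⊓ l)

  Z : ℕ → ℕ → ℕ
  Z i x = ((m ∸ 1) C x) * PF x (i ∸ 1) * Cc (m ∸ 1 ∸ x) (n ∸ i)

  V : ℕ → ℕ → ℕ → ℕ
  V i x R = ((m ∸ 1) C x) * PF x (i ∸ 1) * ((m ∸ 1 ∸ x) C R) * Cc R R
            * Cc (m ∸ 1 ∸ x ∸ R) (n ∸ R ∸ i ∸ 1) * (R ⊓ k)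

  W : ℕ → ℕ → ℕ → ℕ
  W i x R = ((m ∸ 1) C x) * PF x (i ∸ R ∸ 2) * ((m ∸ 1 ∸ x) C R) * Cc R R
            * Cc (m ∸ 1 ∸ x ∸ R) (n ∸ i) * ((R ∸ k) ⊓ l)

  RHS : ℕ
  RHS = sumFT 1 n (λ i → X i + Y i
          + sumFT 0 (m ∸ 1) (λ x → Z i x
               + sumFT 1 (n ∸ i ∸ 1) (λ R → V i x R)
               + sumFT (k + 1) (i ∸ 2) (λ R → W i x R)))

{-# OPTIONS --safe #-}
-- Condition on the spot i where the last car parks; i is vacant when that car arrives.
-- A vacant spot separates the street: the cars preferring spots below i park as in a
-- parking function on 1 … i-1, those preferring spots above i as in a contained parking
-- function on i … n (backing into i would fill it), and the two groups interleave in
-- binomially many ways. The number of preferences sending the last car to i depends only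
-- on the lengths L and R of the occupied runs just below and just above i: it is
-- 1 + min(k, R) plus min(L - k, ℓ), or min(i - 1, ℓ) when the run reaches spot 1.
-- Cutting off that run as a block (counted by C_{R,R}, or by PF_{i-1,i-1} when it reaches
-- spot 1) yields the terms X, Y, Z, V, W.
module Submission where

open import Defs
open import Algebra.Bundles using (CommutativeMonoid)
import Algebra.Properties.CommutativeSemigroup as CommutativeSemigroupProperties
open import Data.Bool using (Bool; true; false; if_then_else_; _∧_; _∨_; not)
open import Data.Bool.ListAction using (all)
open import Data.Bool.Properties using (∧-assoc; ∧-comm; ∧-zeroʳ; ∧-identityʳ; ∨-zeroʳ; ∧-commutativeMonoid)
open import Data.Empty using (⊥; ⊥-elim)
open import Data.Fin using (Fin; toℕ)
open import Data.List using (List; []; _∷_; _++_; map; concatMap; [_]; applyUpTo; length; tabulate; allFin; filter)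
open import Data.List.Membership.Propositional using (_∈_)
open import Data.List.Properties using (++-assoc; map-++; map-tabulate; tabulate-cong; ++-identityʳ; filter-accept; filter-reject)
open import Data.List.Relation.Unary.All using (All; []; _∷_)
import Data.List.Relation.Unary.All as All
open import Data.List.Relation.Unary.All.Properties using (++⁺; all-filter)
open import Data.List.Relation.Unary.Any using (here; there)
open import Data.Maybe using (Maybe; just; nothing)
import Data.Maybe as M
open import Data.Nat
open import Data.Nat.Combinatorics using (_C_; nCk+nC[k+1]≡[n+1]C[k+1]; k>n⇒nCk≡0)
open import Data.Nat.ListAction using (sum)
open import Data.Nat.Properties
open import Data.Nat.Solver using (module +-*-Solver)
open import Data.Product using (∃; _×_; _,_; proj₁; proj₂)
open import Data.Sum using (_⊎_; inj₁; inj₂)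
open import Data.Unit using (⊤; tt)
open import Data.Vec using (Vec) renaming (_∷_ to _∷v_)
open import Function using (_∘_; id)
open import Relation.Binary.PropositionalEquality hiding ([_])
open import Relation.Nullary using (¬_; yes; no; Dec; does)
open import Relation.Nullary.Decidable using (dec-true; dec-false)
open import Relation.Unary using (Decidable; ∁)
open import Relation.Unary.Properties using (∁?)
open ≡-Reasoning
module + = CommutativeSemigroupProperties +-commutativeSemigroup
module ∧ = CommutativeSemigroupProperties (CommutativeMonoid.commutativeSemigroup ∧-commutativeMonoid)

χ : Bool → ℕ
χ true = 1
χ false = 0

∑ : {A : Set} → List A → (A → ℕ) → ℕ
∑ [] f = 0
∑ (x ∷ xs) f = f x + ∑ xs f

∑-cong : {A : Set} (xs : List A) {f g : A → ℕ} → (∀ x → f x ≡ g x) → ∑ xs f ≡ ∑ xs g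
∑-cong [] e = refl
∑-cong (x ∷ xs) e = cong₂ _+_ (e x) (∑-cong xs e)

∑-congAll : {A : Set} {xs : List A} {f g : A → ℕ} → All (λ x → f x ≡ g x) xs → ∑ xs f ≡ ∑ xs g
∑-congAll [] = refl
∑-congAll (e ∷ es) = cong₂ _+_ e (∑-congAll es)

∑-++ : {A : Set} (xs ys : List A) (f : A → ℕ) → ∑ (xs ++ ys) f ≡ ∑ xs f + ∑ ys f
∑-++ [] ys f = refl
∑-++ (x ∷ xs) ys f = trans (cong (f x +_) (∑-++ xs ys f)) (sym (+-assoc (f x) _ _))

∑-+ : {A : Set} (xs : List A) (f g : A → ℕ) → ∑ xs (λ x → f x + g x) ≡ ∑ xs f + ∑ xs g
∑-+ [] f g = refl
∑-+ (x ∷ xs) f g = trans (cong (f x + g x +_) (∑-+ xs f g)) (+.interchange (f x) (g x) _ _)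

∑-*ˡ : {A : Set} (xs : List A) (c : ℕ) (f : A → ℕ) → ∑ xs (λ x → c * f x) ≡ c * ∑ xs f
∑-*ˡ [] c f = sym (*-zeroʳ c)
∑-*ˡ (x ∷ xs) c f = trans (cong (c * f x +_) (∑-*ˡ xs c f)) (sym (*-distribˡ-+ c (f x) _))

∑-*ʳ : {A : Set} (xs : List A) (c : ℕ) (f : A → ℕ) → ∑ xs (λ x → f x * c) ≡ ∑ xs f * c
∑-*ʳ [] c f = refl
∑-*ʳ (x ∷ xs) c f = trans (cong (f x * c +_) (∑-*ʳ xs c f)) (sym (*-distribʳ-+ c (f x) _))

∑-zero : {A : Set} (xs : List A) → ∑ xs (λ _ → 0) ≡ 0
∑-zero [] = refl
∑-zero (x ∷ xs) = ∑-zero xs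

∑-map : {A B : Set} (h : A → B) (xs : List A) (f : B → ℕ) → ∑ (map h xs) f ≡ ∑ xs (λ x → f (h x))
∑-map h [] f = refl
∑-map h (x ∷ xs) f = cong (f (h x) +_) (∑-map h xs f)

∑-concatMap : {A B : Set} (h : A → List B) (xs : List A) (f : B → ℕ) → ∑ (concatMap h xs) f ≡ ∑ xs (λ x → ∑ (h x) f)
∑-concatMap h [] f = refl
∑-concatMap h (x ∷ xs) f = trans (∑-++ (h x) (concatMap h xs) f) (cong (∑ (h x) f +_) (∑-concatMap h xs f))

∑-swap : {A B : Set} (xs : List A) (ys : List B) (f : A → B → ℕ) →
  ∑ xs (λ x → ∑ ys (λ y → f x y)) ≡ ∑ ys (λ y → ∑ xs (λ x → f x y))
∑-swap [] ys f = sym (∑-zero ys)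
∑-swap (x ∷ xs) ys f = trans (cong (∑ ys (f x) +_) (∑-swap xs ys f)) (sym (∑-+ ys (f x) _))

∑< : ℕ → (ℕ → ℕ) → ℕ
∑< zero f = 0
∑< (suc n) f = f 0 + ∑< n (λ j → f (suc j))

∑<-cong : ∀ n {f g : ℕ → ℕ} → (∀ x → f x ≡ g x) → ∑< n f ≡ ∑< n g
∑<-cong zero e = refl
∑<-cong (suc n) e = cong₂ _+_ (e 0) (∑<-cong n (λ x → e (suc x)))

∑<-cong< : ∀ n {f g : ℕ → ℕ} → (∀ x → x < n → f x ≡ g x) → ∑< n f ≡ ∑< n g
∑<-cong< zero e = refl
∑<-cong< (suc n) e = cong₂ _+_ (e 0 z<s) (∑<-cong< n (λ x x<n → e (suc x) (s<s x<n)))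

∑<-+ : ∀ n (f g : ℕ → ℕ) → ∑< n (λ x → f x + g x) ≡ ∑< n f + ∑< n g
∑<-+ zero f g = refl
∑<-+ (suc n) f g = trans (cong (f 0 + g 0 +_) (∑<-+ n _ _)) (+.interchange (f 0) (g 0) _ _)

∑<-*ˡ : ∀ n (c : ℕ) (f : ℕ → ℕ) → ∑< n (λ x → c * f x) ≡ c * ∑< n f
∑<-*ˡ zero c f = sym (*-zeroʳ c)
∑<-*ˡ (suc n) c f = trans (cong (c * f 0 +_) (∑<-*ˡ n c _)) (sym (*-distribˡ-+ c (f 0) _))

∑<-zero : ∀ n → ∑< n (λ _ → 0) ≡ 0
∑<-zero zero = refl
∑<-zero (suc n) = ∑<-zero n

∑<-snoc : ∀ n (f : ℕ → ℕ) → ∑< (suc n) f ≡ ∑< n f + f n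
∑<-snoc zero f = +-comm (f 0) 0
∑<-snoc (suc n) f = trans (cong (f 0 +_) (∑<-snoc n (λ j → f (suc j)))) (sym (+-assoc (f 0) _ _))

∑<-swap : ∀ n m (f : ℕ → ℕ → ℕ) → ∑< n (λ x → ∑< m (λ y → f x y)) ≡ ∑< m (λ y → ∑< n (λ x → f x y))
∑<-swap zero m f = sym (∑<-zero m)
∑<-swap (suc n) m f = trans (cong (∑< m (f 0) +_) (∑<-swap n m _)) (sym (∑<-+ m (f 0) _))

∑<-split : ∀ a b (f : ℕ → ℕ) → ∑< (a + b) f ≡ ∑< a f + ∑< b (λ j → f (a + j))
∑<-split zero b f = refl
∑<-split (suc a) b f = trans (cong (f 0 +_) (∑<-split a b (λ j → f (suc j)))) (sym (+-assoc (f 0) _ _))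

∑<-reverse : ∀ M (g : ℕ → ℕ) → ∑< M (λ j → g (suc j)) ≡ ∑< M (λ j → g (M ∸ j))
∑<-reverse zero g = refl
∑<-reverse (suc M) g = trans (∑<-snoc M (λ j → g (suc j))) (trans (cong (_+ g (suc M)) (∑<-reverse M g)) (+-comm _ (g (suc M))))

∑<-δ : ∀ c u (f : ℕ → ℕ) → u < c → ∑< c (λ R → f R * χ (u ≡ᵇ R)) ≡ f u
∑<-δ (suc c) zero f _ = trans (cong₂ _+_ (*-identityʳ (f 0)) (trans (∑<-cong c (λ R → *-zeroʳ (f (suc R)))) (∑<-zero c))) (+-identityʳ (f 0))
∑<-δ (suc c) (suc u) f (s≤s u<c) = trans (cong (_+ ∑< c (λ R → f (suc R) * χ (u ≡ᵇ R))) (*-zeroʳ (f 0))) (∑<-δ c u (λ R → f (suc R)) u<c)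

∑<-χ<*χ< : ∀ N k u → u ≤ N → ∑< N (λ j → χ (j <ᵇ k) * χ (j <ᵇ u)) ≡ k ⊓ u
∑<-χ<*χ< zero k zero _ = sym (⊓-zeroʳ k)
∑<-χ<*χ< (suc N) k zero _ = trans (∑<-cong (suc N) (λ j → *-zeroʳ (χ (j <ᵇ k)))) (trans (∑<-zero (suc N)) (sym (⊓-zeroʳ k)))
∑<-χ<*χ< (suc N) zero (suc u) _ = ∑<-zero (suc N)
∑<-χ<*χ< (suc N) (suc k) (suc u) (s≤s u≤N) = cong suc (∑<-χ<*χ< N k u u≤N)

∑-∑<-swap : ∀ {A : Set} (xs : List A) N (f : A → ℕ → ℕ) → ∑ xs (λ w → ∑< N (λ R → f w R)) ≡ ∑< N (λ R → ∑ xs (λ w → f w R))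
∑-∑<-swap [] N f = sym (∑<-zero N)
∑-∑<-swap (x ∷ xs) N f = trans (cong (∑< N (f x) +_) (∑-∑<-swap xs N f)) (sym (∑<-+ N (f x) _))

sum-applyUpTo : ∀ n (g h : ℕ → ℕ) → sum (map g (applyUpTo h n)) ≡ ∑< n (λ j → g (h j))
sum-applyUpTo zero g h = refl
sum-applyUpTo (suc n) g h = cong (g (h 0) +_) (sum-applyUpTo n g (λ j → h (suc j)))

sumFT≡∑< : ∀ lo hi f → sumFT lo hi f ≡ ∑< (suc hi ∸ lo) (λ j → f (lo + j))
sumFT≡∑< lo hi f = sum-applyUpTo (suc hi ∸ lo) (λ j → f (lo + j)) (λ j → j)

words : ℕ → List ℕ → List (List ℕ)
words zero A = [] ∷ []
words (suc j) A = concatMap (λ w → map (_∷ w) A) (words j A)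

∑words : ℕ → List ℕ → (List ℕ → ℕ) → ℕ
∑words j A F = ∑ (words j A) F

∑words-cong : ∀ j A {F G : List ℕ → ℕ} → (∀ w → F w ≡ G w) → ∑words j A F ≡ ∑words j A G
∑words-cong j A e = ∑-cong (words j A) e

∑words-suc′ : ∀ j A (F : List ℕ → ℕ) → ∑words (suc j) A F ≡ ∑words j A (λ w → ∑ A (λ x → F (x ∷ w)))
∑words-suc′ j A F = trans (∑-concatMap _ (words j A) F) (∑-cong (words j A) (λ w → ∑-map (_∷ w) A F))

∑words-suc : ∀ j A (F : List ℕ → ℕ) → ∑words (suc j) A F ≡ ∑ A (λ x → ∑words j A (λ w → F (x ∷ w)))
∑words-suc j A F = trans (∑words-suc′ j A F) (∑-swap (words j A) A (λ w x → F (x ∷ w)))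

∑words-zero : ∀ j A → ∑words j A (λ _ → 0) ≡ 0
∑words-zero j A = ∑-zero (words j A)

∑words-congAll : ∀ (P : ℕ → Set) j A {F G : List ℕ → ℕ} → All P A → (∀ w → All P w → F w ≡ G w) → ∑words j A F ≡ ∑words j A G
∑words-congAll P zero A pA h = cong (_+ 0) (h [] [])
∑words-congAll P (suc j) A {F} {G} pA h = begin
  ∑words (suc j) A F                          ≡⟨ ∑words-suc j A F ⟩
  ∑ A (λ x → ∑words j A (λ w → F (x ∷ w)))    ≡⟨ ∑-congAll (All.map (λ px → ∑words-congAll P j A pA (λ w pw → h _ (px ∷ pw))) pA) ⟩
  ∑ A (λ x → ∑words j A (λ w → G (x ∷ w)))    ≡⟨ ∑words-suc j A G ⟨
  ∑words (suc j) A G                          ∎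

∑words-length : ∀ j A (F : ℕ → List ℕ → ℕ) → ∑words j A (λ w → F (length w) w) ≡ ∑words j A (F j)
∑words-length zero A F = refl
∑words-length (suc j) A F = begin
  ∑words (suc j) A (λ w → F (length w) w)                       ≡⟨ ∑words-suc j A _ ⟩
  ∑ A (λ x → ∑words j A (λ w → F (suc (length w)) (x ∷ w)))    ≡⟨ ∑-cong A (λ x → ∑words-length j A (λ n w → F (suc n) (x ∷ w))) ⟩
  ∑ A (λ x → ∑words j A (λ w → F (suc j) (x ∷ w)))             ≡⟨ ∑words-suc j A (F (suc j)) ⟨
  ∑words (suc j) A (F (suc j))                                  ∎

∑words-snoc : ∀ j A (F : List ℕ → ℕ) → ∑words (suc j) A F ≡ ∑words j A (λ w → ∑ A (λ x → F (w ++ [ x ])))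
∑words-snoc zero A F = begin
  ∑words 1 A F               ≡⟨ ∑words-suc zero A F ⟩
  ∑ A (λ x → F [ x ] + 0)    ≡⟨ ∑-cong A (λ x → +-identityʳ (F [ x ])) ⟩
  ∑ A (λ x → F [ x ])        ≡⟨ +-identityʳ _ ⟨
  ∑words zero A (λ w → ∑ A (λ x → F (w ++ [ x ]))) ∎
∑words-snoc (suc j) A F = begin
  ∑words (suc (suc j)) A F                                         ≡⟨ ∑words-suc (suc j) A F ⟩
  ∑ A (λ y → ∑words (suc j) A (λ w → F (y ∷ w)))                   ≡⟨ ∑-cong A (λ y → ∑words-snoc j A (λ w → F (y ∷ w))) ⟩
  ∑ A (λ y → ∑words j A (λ w → ∑ A (λ x → F (y ∷ w ++ [ x ]))))    ≡⟨ ∑words-suc j A _ ⟨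
  ∑words (suc j) A (λ w → ∑ A (λ x → F (w ++ [ x ])))              ∎

∑words-map : ∀ j (f : ℕ → ℕ) A (F : List ℕ → ℕ) → ∑words j (map f A) F ≡ ∑words j A (λ w → F (map f w))
∑words-map zero f A F = refl
∑words-map (suc j) f A F = begin
  ∑words (suc j) (map f A) F                               ≡⟨ ∑words-suc j (map f A) F ⟩
  ∑ (map f A) (λ x → ∑words j (map f A) (λ w → F (x ∷ w)))  ≡⟨ ∑-map f A _ ⟩
  ∑ A (λ a → ∑words j (map f A) (λ w → F (f a ∷ w)))        ≡⟨ ∑-cong A (λ a → ∑words-map j f A (λ w → F (f a ∷ w))) ⟩
  ∑ A (λ a → ∑words j A (λ w → F (f a ∷ map f w)))          ≡⟨ ∑words-suc j A _ ⟨
  ∑words (suc j) A (λ w → F (map f w))                     ∎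

∑words-drop : ∀ j e A (F : List ℕ → ℕ) → (∀ u v → F (u ++ e ∷ v) ≡ 0) → ∑words j (e ∷ A) F ≡ ∑words j A F
∑words-drop zero e A F F-e≡0 = refl
∑words-drop (suc j) e A F F-e≡0 = begin
  ∑words (suc j) (e ∷ A) F
    ≡⟨ ∑words-suc j (e ∷ A) F ⟩
  ∑words j (e ∷ A) (λ w → F (e ∷ w)) + ∑ A (λ x → ∑words j (e ∷ A) (λ w → F (x ∷ w)))
    ≡⟨ cong₂ _+_ (trans (∑words-cong j (e ∷ A) (F-e≡0 [])) (∑words-zero j (e ∷ A)))
                 (∑-cong A (λ x → ∑words-drop j e A (λ w → F (x ∷ w)) (λ u → F-e≡0 (x ∷ u)))) ⟩
  ∑ A (λ x → ∑words j A (λ w → F (x ∷ w)))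
    ≡⟨ ∑words-suc j A F ⟨
  ∑words (suc j) A F ∎

-- Binomial convolution

shuffle : ℕ → (ℕ → ℕ) → (ℕ → ℕ) → ℕ
shuffle zero G H = G 0 * H 0
shuffle (suc j) G H = shuffle j (λ x → G (suc x)) H + shuffle j G (λ y → H (suc y))

shuffle-cong : ∀ j {G G′ H H′ : ℕ → ℕ} → (∀ x → G x ≡ G′ x) → (∀ x → H x ≡ H′ x) → shuffle j G H ≡ shuffle j G′ H′
shuffle-cong zero eG eH = cong₂ _*_ (eG 0) (eH 0)
shuffle-cong (suc j) eG eH = cong₂ _+_ (shuffle-cong j (λ x → eG (suc x)) eH) (shuffle-cong j eG (λ x → eH (suc x)))

shuffle-comm : ∀ j (G H : ℕ → ℕ) → shuffle j G H ≡ shuffle j H G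
shuffle-comm zero G H = *-comm (G 0) (H 0)
shuffle-comm (suc j) G H = trans (cong₂ _+_ (shuffle-comm j (λ x → G (suc x)) H) (shuffle-comm j G (λ y → H (suc y))))
                                 (+-comm (shuffle j H (λ x → G (suc x))) _)

∑-shuffleˡ : ∀ j {A : Set} (xs : List A) (G : A → ℕ → ℕ) (H : ℕ → ℕ) →
  ∑ xs (λ a → shuffle j (G a) H) ≡ shuffle j (λ x → ∑ xs (λ a → G a x)) H
∑-shuffleˡ zero xs G H = ∑-*ʳ xs (H 0) (λ a → G a 0)
∑-shuffleˡ (suc j) xs G H = trans (∑-+ xs _ _)
  (cong₂ _+_ (∑-shuffleˡ j xs (λ a x → G a (suc x)) H) (∑-shuffleˡ j xs G (λ y → H (suc y))))

∑-shuffleʳ : ∀ j {A : Set} (xs : List A) (G : ℕ → ℕ) (H : A → ℕ → ℕ) →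
  ∑ xs (λ a → shuffle j G (H a)) ≡ shuffle j G (λ y → ∑ xs (λ a → H a y))
∑-shuffleʳ zero xs G H = ∑-*ˡ xs (G 0) (λ a → H a 0)
∑-shuffleʳ (suc j) xs G H = trans (∑-+ xs _ _)
  (cong₂ _+_ (∑-shuffleʳ j xs (λ x → G (suc x)) H) (∑-shuffleʳ j xs G (λ a y → H a (suc y))))

shuffle-zeroˡ : ∀ j H → shuffle j (λ _ → 0) H ≡ 0
shuffle-zeroˡ zero H = refl
shuffle-zeroˡ (suc j) H = cong₂ _+_ (shuffle-zeroˡ j H) (shuffle-zeroˡ j _)

shuffle-δˡ : ∀ j R c (H : ℕ → ℕ) → shuffle j (λ x → if x ≡ᵇ R then c else 0) H ≡ (j C R) * c * H (j ∸ R)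
shuffle-δˡ zero zero c H = cong (_* H 0) (sym (+-identityʳ c))
shuffle-δˡ zero (suc R) c H = refl
shuffle-δˡ (suc j) zero c H =
  cong₂ _+_ (shuffle-zeroˡ j H) (shuffle-δˡ j zero c (λ y → H (suc y)))
shuffle-δˡ (suc j) (suc R) c H = begin
  shuffle j (λ x → if x ≡ᵇ R then c else 0) H + shuffle j (λ x → if x ≡ᵇ suc R then c else 0) (λ y → H (suc y))
    ≡⟨ cong₂ _+_ (shuffle-δˡ j R c H) (trans (shuffle-δˡ j (suc R) c (λ y → H (suc y))) shifted) ⟩
  (j C R) * c * H (j ∸ R) + (j C suc R) * c * H (j ∸ R)
    ≡⟨ *-distribʳ-+ (H (j ∸ R)) ((j C R) * c) ((j C suc R) * c) ⟨
  ((j C R) * c + (j C suc R) * c) * H (j ∸ R)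
    ≡⟨ cong (_* H (j ∸ R)) (trans (sym (*-distribʳ-+ c (j C R) (j C suc R))) (cong (_* c) (nCk+nC[k+1]≡[n+1]C[k+1] j R))) ⟩
  (suc j C suc R) * c * H (j ∸ R) ∎
  where
  shifted : (j C suc R) * c * H (suc (j ∸ suc R)) ≡ (j C suc R) * c * H (j ∸ R)
  shifted with suc R ≤? j
  ... | yes R<j = cong (λ z → (j C suc R) * c * H z) (sym (+-∸-assoc 1 R<j))
  ... | no R≮j rewrite k>n⇒nCk≡0 (≰⇒> R≮j) = refl

shuffle≡binomial : ∀ j (G H : ℕ → ℕ) → shuffle j G H ≡ ∑< (suc j) (λ x → (j C x) * G x * H (j ∸ x))
shuffle≡binomial zero G H = sym (trans (+-identityʳ _) (cong (_* H 0) (+-identityʳ (G 0))))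
shuffle≡binomial (suc j) G H = begin
  shuffle j (λ x → G (suc x)) H + shuffle j G (λ y → H (suc y))
    ≡⟨ cong₂ _+_ (shuffle≡binomial j _ H) (trans (shuffle≡binomial j G _) (∑<-cong< (suc j) (λ x x≤j → cong (λ z → (j C x) * G x * H z) (sym (+-∸-assoc 1 (≤-pred x≤j)))))) ⟩
  ∑< (suc j) left + ∑< (suc j) f
    ≡⟨ cong (∑< (suc j) left +_) f-peel ⟩
  ∑< (suc j) left + (G 0 * H (suc j) + ∑< (suc j) right)
    ≡⟨ +.x∙yz≈y∙xz (∑< (suc j) left) (G 0 * H (suc j)) _ ⟩
  G 0 * H (suc j) + (∑< (suc j) left + ∑< (suc j) right)
    ≡⟨ cong₂ _+_ (cong (_* H (suc j)) (sym (+-identityʳ (G 0)))) (sym (∑<-+ (suc j) left right)) ⟩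
  (suc j C 0) * G 0 * H (suc j) + ∑< (suc j) (λ x → left x + right x)
    ≡⟨ cong ((suc j C 0) * G 0 * H (suc j) +_) (∑<-cong (suc j) pascal) ⟩
  ∑< (suc (suc j)) (λ x → (suc j C x) * G x * H (suc j ∸ x)) ∎
  where
  left right f : ℕ → ℕ
  left x = (j C x) * G (suc x) * H (j ∸ x)
  right x = (j C suc x) * G (suc x) * H (j ∸ x)
  f x = (j C x) * G x * H (suc j ∸ x)
  pascal : ∀ x → left x + right x ≡ (suc j C suc x) * G (suc x) * H (j ∸ x)
  pascal x = trans (sym (*-distribʳ-+ (H (j ∸ x)) ((j C x) * G (suc x)) ((j C suc x) * G (suc x))))
    (cong (_* H (j ∸ x)) (trans (sym (*-distribʳ-+ (G (suc x)) (j C x) _)) (cong (_* G (suc x)) (nCk+nC[k+1]≡[n+1]C[k+1] j x))))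
  f-last : f (suc j) ≡ 0
  f-last = cong (λ z → z * G (suc j) * H (j ∸ j)) (k>n⇒nCk≡0 {j} {suc j} ≤-refl)
  f-peel : ∑< (suc j) f ≡ G 0 * H (suc j) + ∑< (suc j) right
  f-peel = begin
    f 0 + ∑< j (λ x → f (suc x))                ≡⟨ cong (f 0 +_) (sym (+-identityʳ _)) ⟩
    f 0 + (∑< j (λ x → f (suc x)) + 0)          ≡⟨ cong (λ z → f 0 + (∑< j (λ x → f (suc x)) + z)) (sym f-last) ⟩
    f 0 + (∑< j (λ x → f (suc x)) + f (suc j))  ≡⟨ cong (f 0 +_) (sym (∑<-snoc j (λ x → f (suc x)))) ⟩
    f 0 + ∑< (suc j) (λ x → f (suc x))          ≡⟨ cong (λ z → z * H (suc j) + ∑< (suc j) right) (+-identityʳ (G 0)) ⟩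
    G 0 * H (suc j) + ∑< (suc j) right          ∎

module _ {P : ℕ → Set} (P? : Decidable P) where

  ∑words-separate : (AL AR : List ℕ) → All P AL → All (∁ P) AR → ∀ j (g h : List ℕ → ℕ) →
    ∑words j (AL ++ AR) (λ w → g (filter P? w) * h (filter (∁? P?) w)) ≡ shuffle j (λ x → ∑words x AL g) (λ y → ∑words y AR h)
  ∑words-separate AL AR pL pR zero g h =
    trans (+-identityʳ _) (cong₂ _*_ (sym (+-identityʳ (g []))) (sym (+-identityʳ (h []))))
  ∑words-separate AL AR pL pR (suc j) g h = begin
    ∑words (suc j) (AL ++ AR) F
      ≡⟨ ∑words-suc j _ F ⟩
    ∑ (AL ++ AR) (λ a → ∑words j (AL ++ AR) (λ w → F (a ∷ w)))
      ≡⟨ ∑-++ AL AR _ ⟩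
    ∑ AL (λ a → ∑words j (AL ++ AR) (λ w → F (a ∷ w))) + ∑ AR (λ a → ∑words j (AL ++ AR) (λ w → F (a ∷ w)))
      ≡⟨ cong₂ _+_ (∑-congAll (All.map leftLetter pL)) (∑-congAll (All.map rightLetter pR)) ⟩
    ∑ AL (λ a → shuffle j (λ x → ∑words x AL (λ u → g (a ∷ u))) H) + ∑ AR (λ a → shuffle j G (λ y → ∑words y AR (λ v → h (a ∷ v))))
      ≡⟨ cong₂ _+_ (∑-shuffleˡ j AL (λ a x → ∑words x AL (λ u → g (a ∷ u))) H) (∑-shuffleʳ j AR G (λ a y → ∑words y AR (λ v → h (a ∷ v)))) ⟩
    shuffle j (λ x → ∑ AL (λ a → ∑words x AL (λ u → g (a ∷ u)))) H + shuffle j G (λ y → ∑ AR (λ a → ∑words y AR (λ v → h (a ∷ v))))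
      ≡⟨ cong₂ _+_ (shuffle-cong j (λ x → sym (∑words-suc x AL g)) (λ _ → refl)) (shuffle-cong j (λ _ → refl) (λ y → sym (∑words-suc y AR h))) ⟩
    shuffle (suc j) G H ∎
    where
    F : List ℕ → ℕ
    F w = g (filter P? w) * h (filter (∁? P?) w)
    G H : ℕ → ℕ
    G x = ∑words x AL g
    H y = ∑words y AR h
    leftLetter : ∀ {a} → P a → ∑words j (AL ++ AR) (λ w → F (a ∷ w)) ≡ shuffle j (λ x → ∑words x AL (λ u → g (a ∷ u))) H
    leftLetter {a} pa = trans
      (∑words-cong j _ (λ w → cong₂ (λ u v → g u * h v) (filter-accept P? pa) (filter-reject (∁? P?) (λ ¬pa → ¬pa pa))))
      (∑words-separate AL AR pL pR j (λ u → g (a ∷ u)) h)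
    rightLetter : ∀ {a} → ∁ P a → ∑words j (AL ++ AR) (λ w → F (a ∷ w)) ≡ shuffle j G (λ y → ∑words y AR (λ v → h (a ∷ v)))
    rightLetter {a} ¬pa = trans
      (∑words-cong j _ (λ w → cong₂ (λ u v → g u * h v) (filter-reject P? ¬pa) (filter-accept (∁? P?) ¬pa)))
      (∑words-separate AL AR pL pR j g (λ v → h (a ∷ v)))

true≢false : true ≢ false
true≢false ()

does-true⇒ : ∀ {A : Set} (a? : Dec A) → does a? ≡ true → A
does-true⇒ (yes a) _ = a

does-false⇒ : ∀ {A : Set} (a? : Dec A) → does a? ≡ false → ¬ A
does-false⇒ (no ¬a) _ = ¬a

≡ᵇ-refl : ∀ n → (n ≡ᵇ n) ≡ true
≡ᵇ-refl n = dec-true (n ≟ n) refl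

≢⇒≡ᵇ≡false : ∀ m n → m ≢ n → (m ≡ᵇ n) ≡ false
≢⇒≡ᵇ≡false m n = dec-false (m ≟ n)

≡ᵇ≡true⇒≡ : ∀ m n → (m ≡ᵇ n) ≡ true → m ≡ n
≡ᵇ≡true⇒≡ m n = does-true⇒ (m ≟ n)

<⇒<ᵇ≡true : ∀ m n → m < n → (m <ᵇ n) ≡ true
<⇒<ᵇ≡true m n = dec-true (m <? n)

≥⇒<ᵇ≡false : ∀ m n → n ≤ m → (m <ᵇ n) ≡ false
≥⇒<ᵇ≡false m n n≤m = dec-false (m <? n) (≤⇒≯ n≤m)

≤⇒≤ᵇ≡true : ∀ m n → m ≤ n → (m ≤ᵇ n) ≡ true
≤⇒≤ᵇ≡true m n = dec-true (m ≤? n)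

>⇒≤ᵇ≡false : ∀ m n → n < m → (m ≤ᵇ n) ≡ false
>⇒≤ᵇ≡false m n n<m = dec-false (m ≤? n) (<⇒≱ n<m)

≤ᵇ≡true⇒≤ : ∀ m n → (m ≤ᵇ n) ≡ true → m ≤ n
≤ᵇ≡true⇒≤ m n = does-true⇒ (m ≤? n)

≤ᵇ≡false⇒> : ∀ m n → (m ≤ᵇ n) ≡ false → n < m
≤ᵇ≡false⇒> m n e = ≰⇒> (does-false⇒ (m ≤? n) e)

-- Occupancies are predicates rather than the lists of `run`, so that
-- agreement on a region and translation of a street are pointwise notions.
Occupancy : Set
Occupancy = ℕ → Bool

∅ : Occupancy
∅ _ = false

occupy : Occupancy → ℕ → Occupancy
occupy O s t = (t ≡ᵇ s) ∨ O t

firstVacant : Occupancy → List ℕ → Maybe ℕ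
firstVacant O [] = nothing
firstVacant O (s ∷ ss) = if O s then firstVacant O ss else just s

candidates : ℕ → ℕ → ℕ → ℕ → ℕ → List ℕ
candidates lo b k l a = a ∷ back lo a k ++ fwd b a l

mutual
  park : (ℕ → List ℕ) → Occupancy → List ℕ → Maybe Occupancy
  park c O [] = just O
  park c O (a ∷ w) = park′ c w (firstVacant O (c a)) O

  park′ : (ℕ → List ℕ) → List ℕ → Maybe ℕ → Occupancy → Maybe Occupancy
  park′ c w nothing O = nothing
  park′ c w (just s) O = park c (occupy O s) w

weight : (Occupancy → ℕ) → Maybe Occupancy → ℕ
weight T nothing = 0
weight T (just O) = T O

parkWeight : (ℕ → List ℕ) → (Occupancy → ℕ) → Occupancy → List ℕ → ℕ
parkWeight c T O w = weight T (park c O w)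

occupancyOf : List ℕ → Occupancy
occupancyOf occ s = occupied s occ

firstVacant≡firstFree : ∀ occ xs → firstVacant (occupancyOf occ) xs ≡ firstFree occ xs
firstVacant≡firstFree occ [] = refl
firstVacant≡firstFree occ (x ∷ xs) with occupied x occ
... | true = firstVacant≡firstFree occ xs
... | false = refl

park≡run : ∀ lo b k l occ w → park (candidates lo b k l) (occupancyOf occ) w ≡ M.map occupancyOf (run lo b k l occ w)
park≡run lo b k l occ [] = refl
park≡run lo b k l occ (a ∷ w) rewrite firstVacant≡firstFree occ (candidates lo b k l a) with firstFree occ (candidates lo b k l a)
... | nothing = refl
... | just s = park≡run lo b k l (s ∷ occ) w

firstVacant-++ : ∀ O xs ys → firstVacant O (xs ++ ys) ≡ M.maybe just (firstVacant O ys) (firstVacant O xs)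
firstVacant-++ O [] ys = refl
firstVacant-++ O (x ∷ xs) ys with O x
... | true = firstVacant-++ O xs ys
... | false = refl

firstVacant-vacant : ∀ O xs {s} → firstVacant O xs ≡ just s → O s ≡ false
firstVacant-vacant O (x ∷ xs) e with O x in Ox
... | true = firstVacant-vacant O xs e
... | false with refl ← e = Ox

firstVacant-All : ∀ {P : ℕ → Set} O xs {s} → All P xs → firstVacant O xs ≡ just s → P s
firstVacant-All O (x ∷ xs) (px ∷ pxs) e with O x
... | true = firstVacant-All O xs pxs e
... | false with refl ← e = px

firstVacant-++-∈ : ∀ O e xs ys → O e ≡ false → e ∈ xs → firstVacant O (xs ++ ys) ≡ firstVacant O xs
firstVacant-++-∈ O e (x ∷ xs) ys Oe (here refl) rewrite Oe = refl
firstVacant-++-∈ O e (x ∷ xs) ys Oe (there e∈xs) with O x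
... | true = firstVacant-++-∈ O e xs ys Oe e∈xs
... | false = refl

occupy-self : ∀ O s → occupy O s s ≡ true
occupy-self O s rewrite ≡ᵇ-refl s = refl

occupy-other : ∀ O s t → t ≢ s → occupy O s t ≡ O t
occupy-other O s t t≢s rewrite ≢⇒≡ᵇ≡false t s t≢s = refl

occupy-mono : ∀ O s t → O t ≡ true → occupy O s t ≡ true
occupy-mono O s t Ot rewrite Ot = ∨-zeroʳ (t ≡ᵇ s)

mutual
  park-mono : ∀ c O w {O′} t → park c O w ≡ just O′ → O t ≡ true → O′ t ≡ true
  park-mono c O [] t refl Ot = Ot
  park-mono c O (a ∷ w) t r Ot = park′-mono c w (firstVacant O (c a)) O t r Ot

  park′-mono : ∀ c w ms O {O′} t → park′ c w ms O ≡ just O′ → O t ≡ true → O′ t ≡ true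
  park′-mono c w (just s) O t r Ot = park-mono c (occupy O s) w t r (occupy-mono O s t Ot)

ifVacant : ℕ → (Occupancy → ℕ) → Occupancy → ℕ
ifVacant e T O = if O e then 0 else T O

parkWeight-occupied : ∀ c e T O w → O e ≡ true → parkWeight c (ifVacant e T) O w ≡ 0
parkWeight-occupied c e T O w Oe with park c O w in eq
... | nothing = refl
... | just O′ rewrite park-mono c O w e eq Oe = refl

AgreeOn : (ℕ → Set) → Occupancy → Occupancy → Set
AgreeOn Reg O P = ∀ t → Reg t → O t ≡ P t

AgreeOn? : (ℕ → Set) → Maybe Occupancy → Maybe Occupancy → Set
AgreeOn? Reg (just O) (just P) = AgreeOn Reg O P
AgreeOn? Reg nothing nothing = ⊤
AgreeOn? Reg _ _ = ⊥

DependsOn : (ℕ → Set) → (Occupancy → ℕ) → Set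
DependsOn Reg T = ∀ O P → AgreeOn Reg O P → T O ≡ T P

firstVacant-agree : ∀ {Reg} O P xs → All Reg xs → AgreeOn Reg O P → firstVacant O xs ≡ firstVacant P xs
firstVacant-agree O P [] [] ag = refl
firstVacant-agree O P (x ∷ xs) (rx ∷ rs) ag rewrite ag x rx with P x
... | true = firstVacant-agree O P xs rs ag
... | false = refl

occupy-agree : ∀ {Reg} O P s → AgreeOn Reg O P → AgreeOn Reg (occupy O s) (occupy P s)
occupy-agree O P s ag t rt rewrite ag t rt = refl

park-agree : ∀ {Reg} c O P w → All (λ a → All Reg (c a)) w → AgreeOn Reg O P → AgreeOn? Reg (park c O w) (park c P w)
park-agree c O P [] [] ag = ag
park-agree c O P (a ∷ w) (ra ∷ rw) ag rewrite firstVacant-agree O P (c a) ra ag with firstVacant P (c a)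
... | nothing = tt
... | just s = park-agree c (occupy O s) (occupy P s) w rw (occupy-agree O P s ag)

weight-agree : ∀ {Reg} T → DependsOn Reg T → ∀ mO mP → AgreeOn? Reg mO mP → weight T mO ≡ weight T mP
weight-agree T T-dep (just O) (just P) ag = T-dep O P ag
weight-agree T T-dep nothing nothing _ = refl

parkWeight-agree : ∀ {Reg} c T → DependsOn Reg T → ∀ O P w → All (λ a → All Reg (c a)) w → AgreeOn Reg O P →
  parkWeight c T O w ≡ parkWeight c T P w
parkWeight-agree c T T-dep O P w rw ag = weight-agree T T-dep (park c O w) (park c P w) (park-agree c O P w rw ag)

data NilOrHead (e : ℕ) : List ℕ → Set where
  nil : NilOrHead e []
  cons : ∀ r → NilOrHead e (e ∷ r)

firstVacant-NilOrHead : ∀ O e {rest} → NilOrHead e rest → O e ≡ false →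
  (firstVacant O rest ≡ nothing) ⊎ (firstVacant O rest ≡ just e)
firstVacant-NilOrHead O e nil Oe = inj₁ refl
firstVacant-NilOrHead O e (cons r) Oe rewrite Oe = inj₂ refl

back-< : ∀ lo a k → All (_< a) (back lo a k)
back-< lo a zero = []
back-< lo zero (suc k) = []
back-< lo (suc a) (suc k) with lo ≤ᵇ a
... | true = ≤-refl ∷ All.map m<n⇒m<1+n (back-< lo a k)
... | false = []

back-≥ : ∀ lo a k → All (lo ≤_) (back lo a k)
back-≥ lo a zero = []
back-≥ lo zero (suc k) = []
back-≥ lo (suc a) (suc k) with lo ≤ᵇ a in lo≤ᵇa
... | true = ≤ᵇ≡true⇒≤ lo a lo≤ᵇa ∷ back-≥ lo a k
... | false = []

fwd-> : ∀ b a l → All (a <_) (fwd b a l)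
fwd-> b a zero = []
fwd-> b a (suc l) with suc a ≤ᵇ b
... | true = ≤-refl ∷ All.map (<-trans (n<1+n a)) (fwd-> b (suc a) l)
... | false = []

fwd-≤ : ∀ b a l → All (_≤ b) (fwd b a l)
fwd-≤ b a zero = []
fwd-≤ b a (suc l) with suc a ≤ᵇ b in a<ᵇb
... | true = ≤ᵇ≡true⇒≤ (suc a) b a<ᵇb ∷ fwd-≤ b (suc a) l
... | false = []

fwd-split : ∀ e b l a → a < e → e ≤ b →
  ∃ λ rest → (fwd b a l ≡ fwd (e ∸ 1) a l ++ rest) × NilOrHead e rest
fwd-split e b zero a a<e e≤b = [] , refl , nil
fwd-split e b (suc l) a a<e e≤b with suc a ≤ᵇ b in a<ᵇb | suc a ≤ᵇ e ∸ 1 in a<ᵇe-1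
... | false | _ = ⊥-elim (<⇒≱ (≤ᵇ≡false⇒> (suc a) b a<ᵇb) (≤-trans a<e e≤b))
... | true | true with fwd-split e b l (suc a) (≤-<-trans (≤ᵇ≡true⇒≤ (suc a) (e ∸ 1) a<ᵇe-1) (∸-monoʳ-< z<s (≤-trans (s≤s z≤n) a<e))) e≤b
...   | rest , eq , r = rest , cong (suc a ∷_) eq , r
fwd-split e b (suc l) a a<e e≤b | true | false =
  suc a ∷ fwd b (suc a) l , refl , subst (λ s → NilOrHead s (suc a ∷ fwd b (suc a) l)) (sym e≡1+a) (cons _)
  where
  e≡1+a : e ≡ suc a
  e≡1+a = ≤-antisym (≤-trans (m≤n+m∸n e 1) (≤ᵇ≡false⇒> (suc a) (e ∸ 1) a<ᵇe-1)) a<e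

back-split : ∀ lo e a k → lo ≤ e → e ≤ a →
  (back lo a k ≡ back e a k) ⊎ (e ∈ a ∷ back e a k × ∃ λ rest → back lo a k ≡ back e a k ++ rest)
back-split lo e a zero _ _ = inj₁ refl
back-split lo e zero (suc k) _ _ = inj₁ refl
back-split lo e (suc a) (suc k) lo≤e e≤1+a with e ≤ᵇ a in e≤ᵇa
... | true rewrite ≤⇒≤ᵇ≡true lo a (≤-trans lo≤e (≤ᵇ≡true⇒≤ e a e≤ᵇa)) with back-split lo e a k lo≤e (≤ᵇ≡true⇒≤ e a e≤ᵇa)
...   | inj₁ eq = inj₁ (cong (a ∷_) eq)
...   | inj₂ (e∈ , rest , eq) = inj₂ (there e∈ , rest , cong (a ∷_) eq)
back-split lo e (suc a) (suc k) lo≤e e≤1+a | false =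
  inj₂ (here (≤-antisym e≤1+a (≤ᵇ≡false⇒> e a e≤ᵇa)) , back lo (suc a) (suc k) , refl)

back-split-0 : ∀ a k → ∃ λ rest → (back 0 a k ≡ back 1 a k ++ rest) × NilOrHead 0 rest
back-split-0 a zero = [] , refl , nil
back-split-0 zero (suc k) = [] , refl , nil
back-split-0 (suc zero) (suc k) = 0 ∷ back 0 0 k , refl , cons _
back-split-0 (suc (suc a)) (suc k) with back-split-0 (suc a) k
... | rest , eq , r = rest , cong (suc a ∷_) eq , r

-- While spot e stays vacant, a car preferring a < e parks as on the street lo … e-1
-- (unless it takes e itself), and a car preferring a ≥ e parks as on the street
-- e … b, because backing up it meets the vacant spot e first.
module Separation (k l lo b e : ℕ) (lo≤e : lo ≤ e) (e≤b : e ≤ b) (1≤e : 1 ≤ e) where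
  cB cL cR : ℕ → List ℕ
  cB = candidates lo b k l
  cL = candidates lo (e ∸ 1) k l
  cR = candidates e b k l

  fL fR : List ℕ → List ℕ
  fL = filter (_<? e)
  fR = filter (∁? (_<? e))

  cL-< : ∀ a → a < e → All (_< e) (cL a)
  cL-< a a<e = a<e ∷ ++⁺ (All.map (λ p → <-trans p a<e) (back-< lo a k))
                         (All.map (λ p → ≤-<-trans p (∸-monoʳ-< z<s 1≤e)) (fwd-≤ (e ∸ 1) a l))

  cR-≥ : ∀ a → e ≤ a → All (e ≤_) (cR a)
  cR-≥ a e≤a = e≤a ∷ ++⁺ (back-≥ e a k) (All.map (λ p → ≤-trans e≤a (<⇒≤ p)) (fwd-> b a l))

  firstVacant-cB : ∀ O a {rest} → fwd b a l ≡ fwd (e ∸ 1) a l ++ rest →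
    firstVacant O (cB a) ≡ M.maybe just (firstVacant O rest) (firstVacant O (cL a))
  firstVacant-cB O a {rest} eq = begin
    firstVacant O (a ∷ back lo a k ++ fwd b a l)                  ≡⟨ cong (λ z → firstVacant O (a ∷ back lo a k ++ z)) eq ⟩
    firstVacant O (a ∷ back lo a k ++ fwd (e ∸ 1) a l ++ rest)    ≡⟨ cong (λ z → firstVacant O (a ∷ z)) (sym (++-assoc (back lo a k) _ rest)) ⟩
    firstVacant O (cL a ++ rest)                                 ≡⟨ firstVacant-++ O (cL a) rest ⟩
    M.maybe just (firstVacant O rest) (firstVacant O (cL a))     ∎

  firstVacant-left : ∀ O a → a < e → O e ≡ false →
    (∃ λ s → (firstVacant O (cL a) ≡ just s) × (firstVacant O (cB a) ≡ just s)) ⊎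
    ((firstVacant O (cL a) ≡ nothing) × ((firstVacant O (cB a) ≡ nothing) ⊎ (firstVacant O (cB a) ≡ just e)))
  firstVacant-left O a a<e Oe with fwd-split e b l a a<e e≤b
  ... | rest , eq , r with firstVacant O (cL a) | firstVacant-cB O a eq | firstVacant-NilOrHead O e r Oe
  ...   | just s | eqB | _ = inj₁ (s , refl , eqB)
  ...   | nothing | eqB | inj₁ q = inj₂ (refl , inj₁ (trans eqB q))
  ...   | nothing | eqB | inj₂ q = inj₂ (refl , inj₂ (trans eqB q))

  firstVacant-right : ∀ O a → e ≤ a → O e ≡ false → firstVacant O (cB a) ≡ firstVacant O (cR a)
  firstVacant-right O a e≤a Oe with back-split lo e a k lo≤e e≤a
  ... | inj₁ eq = cong (λ z → firstVacant O (a ∷ z ++ fwd b a l)) eq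
  ... | inj₂ (e∈ , rest , eq) = begin
    firstVacant O (a ∷ back lo a k ++ fwd b a l)             ≡⟨ cong (λ z → firstVacant O (a ∷ z ++ fwd b a l)) eq ⟩
    firstVacant O (a ∷ (back e a k ++ rest) ++ fwd b a l)    ≡⟨ cong (λ z → firstVacant O (a ∷ z)) (++-assoc (back e a k) rest (fwd b a l)) ⟩
    firstVacant O ((a ∷ back e a k) ++ rest ++ fwd b a l)    ≡⟨ firstVacant-++-∈ O e (a ∷ back e a k) _ Oe e∈ ⟩
    firstVacant O (a ∷ back e a k)                           ≡⟨ firstVacant-++-∈ O e (a ∷ back e a k) _ Oe e∈ ⟨
    firstVacant O (a ∷ back e a k ++ fwd b a l)              ∎

  module Weights (T1 T2 : Occupancy → ℕ) (T1-dep : DependsOn (_< e) T1) (T2-dep : DependsOn (e ≤_) T2) where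
    wB wL wR : Occupancy → List ℕ → ℕ
    wB = parkWeight cB (ifVacant e (λ O → T1 O * T2 O))
    wL = parkWeight cL T1
    wR = parkWeight cR (ifVacant e T2)

    ifVacant-T2-dep : DependsOn (e ≤_) (ifVacant e T2)
    ifVacant-T2-dep O P ag rewrite ag e ≤-refl with P e
    ... | true = refl
    ... | false = T2-dep O P ag

    wL-agree : ∀ O P w → AgreeOn (_< e) O P → wL O (fL w) ≡ wL P (fL w)
    wL-agree O P w = parkWeight-agree cL T1 T1-dep O P (fL w) (All.map (cL-< _) (all-filter (_<? e) w))

    wR-agree : ∀ O P w → AgreeOn (e ≤_) O P → wR O (fR w) ≡ wR P (fR w)
    wR-agree O P w = parkWeight-agree cR (ifVacant e T2) ifVacant-T2-dep O P (fR w) (All.map (cR-≥ _ ∘ ≮⇒≥) (all-filter (∁? (_<? e)) w))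

    parkWeight-separates : ∀ w O → O e ≡ false → wB O w ≡ wL O (fL w) * wR O (fR w)
    parkWeight-separates [] O Oe rewrite Oe = refl
    parkWeight-separates (a ∷ w) O Oe with a <? e
    ... | yes a<e rewrite filter-accept (_<? e) {a} {w} a<e | filter-reject (∁? (_<? e)) {a} {w} (λ a≮e → a≮e a<e) =
      leftCar (firstVacant-left O a a<e Oe)
      where
      leftCar : _ → weight _ (park′ cB w (firstVacant O (cB a)) O) ≡ weight T1 (park′ cL (fL w) (firstVacant O (cL a)) O) * wR O (fR w)
      leftCar (inj₁ (s , eL , eB)) rewrite eL | eB = begin
        wB (occupy O s) w                                ≡⟨ parkWeight-separates w (occupy O s) (trans (occupy-other O s e (>⇒≢ s<e)) Oe) ⟩
        wL (occupy O s) (fL w) * wR (occupy O s) (fR w)  ≡⟨ cong (wL (occupy O s) (fL w) *_) (wR-agree (occupy O s) O w ag) ⟩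
        wL (occupy O s) (fL w) * wR O (fR w)             ∎
        where
        s<e : s < e
        s<e = firstVacant-All O (cL a) (cL-< a a<e) eL
        ag : AgreeOn (e ≤_) (occupy O s) O
        ag t e≤t = occupy-other O s t (>⇒≢ (<-≤-trans s<e e≤t))
      leftCar (inj₂ (eL , inj₁ eB)) rewrite eL | eB = refl
      leftCar (inj₂ (eL , inj₂ eB)) rewrite eL | eB = parkWeight-occupied cB e _ (occupy O e) w (occupy-self O e)
    ... | no a≮e rewrite filter-reject (_<? e) {a} {w} a≮e | filter-accept (∁? (_<? e)) {a} {w} a≮e
                       | firstVacant-right O a (≮⇒≥ a≮e) Oe = rightCar (firstVacant O (cR a)) refl
      where
      rightCar : ∀ ms → firstVacant O (cR a) ≡ ms →
        weight _ (park′ cB w ms O) ≡ wL O (fL w) * weight (ifVacant e T2) (park′ cR (fR w) ms O)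
      rightCar nothing _ = sym (*-zeroʳ (wL O (fL w)))
      rightCar (just s) eR with s ≟ e
      ... | yes refl = trans (parkWeight-occupied cB e _ (occupy O e) w (occupy-self O e))
                         (sym (trans (cong (wL O (fL w) *_) (parkWeight-occupied cR e T2 (occupy O e) (fR w) (occupy-self O e)))
                                     (*-zeroʳ (wL O (fL w)))))
      ... | no s≢e = begin
        wB (occupy O s) w                                ≡⟨ parkWeight-separates w (occupy O s) (trans (occupy-other O s e (s≢e ∘ sym)) Oe) ⟩
        wL (occupy O s) (fL w) * wR (occupy O s) (fR w)  ≡⟨ cong (_* wR (occupy O s) (fR w)) (wL-agree (occupy O s) O w ag) ⟩
        wL O (fL w) * wR (occupy O s) (fR w)             ∎
        where
        e≤s : e ≤ s
        e≤s = firstVacant-All O (cR a) (cR-≥ a (≮⇒≥ a≮e)) eR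
        ag : AgreeOn (_< e) (occupy O s) O
        ag t t<e = occupy-other O s t (<⇒≢ (<-≤-trans t<e e≤s))

spots : ℕ → ℕ → List ℕ
spots s zero = []
spots s (suc c) = s ∷ spots (suc s) c

spots-++ : ∀ s a c → spots s (a + c) ≡ spots s a ++ spots (s + a) c
spots-++ s zero c = cong (λ z → spots z c) (sym (+-identityʳ s))
spots-++ s (suc a) c = cong (s ∷_) (trans (spots-++ (suc s) a c) (cong (λ z → spots (suc s) a ++ spots z c) (sym (+-suc s a))))

spots-shift : ∀ e s c → spots (e + s) c ≡ map (e +_) (spots s c)
spots-shift e s zero = refl
spots-shift e s (suc c) = cong (e + s ∷_) (trans (cong (λ z → spots z c) (sym (+-suc e s))) (spots-shift e (suc s) c))

spots-bounds : ∀ s c → All (λ x → s ≤ x × x < s + c) (spots s c)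
spots-bounds s zero = []
spots-bounds s (suc c) = (≤-refl , subst (s <_) (sym (+-suc s c)) (s≤s (m≤m+n s c))) ∷ All.map widen (spots-bounds (suc s) c)
  where
  widen : ∀ {x} → suc s ≤ x × x < suc s + c → s ≤ x × x < s + suc c
  widen {x} (p , q) = ≤-trans (n≤1+n s) p , subst (x <_) (sym (+-suc s c)) q

∑-spots : ∀ s c (f : ℕ → ℕ) → ∑ (spots s c) f ≡ ∑< c (λ j → f (s + j))
∑-spots s zero f = refl
∑-spots s (suc c) f = cong₂ _+_ (cong f (sym (+-identityʳ s))) (trans (∑-spots (suc s) c f) (∑<-cong c (λ j → cong f (sym (+-suc s j)))))

allFin-spots : ∀ b → map (λ j → suc (toℕ j)) (allFin b) ≡ spots 1 b
allFin-spots b = trans (map-tabulate id (λ j → suc (toℕ j))) (tabulate-spots b 1)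
  where
  tabulate-spots : ∀ c s → tabulate {n = c} (λ j → s + toℕ j) ≡ spots s c
  tabulate-spots zero s = refl
  tabulate-spots (suc c) s = cong₂ _∷_ (+-identityʳ s) (trans (tabulate-cong (λ j → +-suc s (toℕ j))) (tabulate-spots c (suc s)))

∑-allVecs : ∀ a b (F : List ℕ → ℕ) → ∑ (allVecs a b) (λ v → F (prefs v)) ≡ ∑words a (spots 1 b) F
∑-allVecs zero b F = refl
∑-allVecs (suc a) b F = begin
  ∑ (allVecs (suc a) b) (λ v → F (prefs v))
    ≡⟨ ∑-concatMap _ (allVecs a b) _ ⟩
  ∑ (allVecs a b) (λ v → ∑ (map (_∷v v) (allFin b)) (λ v → F (prefs v)))
    ≡⟨ ∑-cong (allVecs a b) (λ v → ∑-map _ (allFin b) _) ⟩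
  ∑ (allVecs a b) (λ v → ∑ (allFin b) (λ j → F (suc (toℕ j) ∷ prefs v)))
    ≡⟨ ∑-allVecs a b (λ w → ∑ (allFin b) (λ j → F (suc (toℕ j) ∷ w))) ⟩
  ∑words a (spots 1 b) (λ w → ∑ (allFin b) (λ j → F (suc (toℕ j) ∷ w)))
    ≡⟨ ∑words-cong a _ (λ w → sym (∑-map (λ j → suc (toℕ j)) (allFin b) (λ x → F (x ∷ w)))) ⟩
  ∑words a (spots 1 b) (λ w → ∑ (map (λ j → suc (toℕ j)) (allFin b)) (λ x → F (x ∷ w)))
    ≡⟨ cong (λ z → ∑words a (spots 1 b) (λ w → ∑ z (λ x → F (x ∷ w)))) (allFin-spots b) ⟩
  ∑words a (spots 1 b) (λ w → ∑ (spots 1 b) (λ x → F (x ∷ w)))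
    ≡⟨ ∑words-suc′ a _ F ⟨
  ∑words (suc a) (spots 1 b) F ∎

countTrue≡∑ : ∀ {A : Set} (p : A → Bool) xs → countTrue p xs ≡ ∑ xs (λ x → if p x then 1 else 0)
countTrue≡∑ p [] = refl
countTrue≡∑ p (x ∷ xs) = cong ((if p x then 1 else 0) +_) (countTrue≡∑ p xs)

isJust-map : ∀ {A B : Set} (f : A → B) r → isJust (M.map f r) ≡ isJust r
isJust-map f nothing = refl
isJust-map f (just _) = refl

module _ (k l : ℕ) where
  ∑park : ℕ → ℕ → ℕ → (Occupancy → ℕ) → ℕ
  ∑park lo b j T = ∑words j (spots 1 b) (parkWeight (candidates lo b k l) T ∅)

  firstVacant-candidates-0-split : ∀ b O a {rest} → back 0 a k ≡ back 1 a k ++ rest →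
    firstVacant O (candidates 0 b k l a) ≡ M.maybe just (firstVacant O (rest ++ fwd b a l)) (firstVacant O (a ∷ back 1 a k))
  firstVacant-candidates-0-split b O a {rest} eq =
    trans (cong (λ z → firstVacant O (a ∷ z)) (trans (cong (_++ fwd b a l) eq) (++-assoc (back 1 a k) rest (fwd b a l))))
          (firstVacant-++ O (a ∷ back 1 a k) (rest ++ fwd b a l))

  firstVacant-candidates-0 : ∀ b O a → O 0 ≡ false →
    (firstVacant O (candidates 0 b k l a) ≡ just 0) ⊎ (firstVacant O (candidates 0 b k l a) ≡ firstVacant O (candidates 1 b k l a))
  firstVacant-candidates-0 b O a O0 with back-split-0 a k
  ... | _ , eq , nil = inj₂ (cong (λ z → firstVacant O (a ∷ z ++ fwd b a l)) (trans eq (++-identityʳ (back 1 a k))))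
  ... | _ , eq , cons r with firstVacant O (a ∷ back 1 a k) | firstVacant-candidates-0-split b O a eq | firstVacant-++ O (a ∷ back 1 a k) (fwd b a l)
  ...   | just s | c0 | c1 = inj₂ (trans c0 (sym c1))
  ...   | nothing | c0 | _ = inj₁ (trans c0 (cong (λ x → if x then firstVacant O (r ++ fwd b a l) else just 0) O0))

  mutual
    park-avoiding-0 : ∀ b O w {O′} → park (candidates 0 b k l) O w ≡ just O′ → O′ 0 ≡ false → park (candidates 1 b k l) O w ≡ just O′
    park-avoiding-0 b O [] r O′0 = r
    park-avoiding-0 b O (a ∷ w) {O′} r O′0 with firstVacant-candidates-0 b O a O0
      where
      O0 : O 0 ≡ false
      O0 with O 0 in eq
      ... | false = refl
      ... | true = sym (trans (sym O′0) (park-mono (candidates 0 b k l) O (a ∷ w) 0 r eq))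
    ... | inj₁ c0 rewrite c0 = ⊥-elim (true≢false (trans (sym (park-mono (candidates 0 b k l) (occupy O 0) w 0 r (occupy-self O 0))) O′0))
    ... | inj₂ c0≡c1 = subst (λ ms → park′ (candidates 1 b k l) w ms O ≡ just O′) c0≡c1 (park′-avoiding-0 b w (firstVacant O (candidates 0 b k l a)) O r O′0)

    park′-avoiding-0 : ∀ b w ms O {O′} → park′ (candidates 0 b k l) w ms O ≡ just O′ → O′ 0 ≡ false → park′ (candidates 1 b k l) w ms O ≡ just O′
    park′-avoiding-0 b w (just s) O r O′0 = park-avoiding-0 b (occupy O s) w r O′0

  isPF≡parkWeight : ∀ a b (v : Vec (Fin b) a) → (if isPF k l v then 1 else 0) ≡ parkWeight (candidates 1 b k l) (λ _ → 1) ∅ (prefs v)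
  isPF≡parkWeight a b v rewrite park≡run 1 b k l [] (prefs v) with run 1 b k l [] (prefs v)
  ... | nothing = refl
  ... | just _ = refl

  numPF≡∑park : ∀ a b → numPF k l a b ≡ ∑park 1 b a (λ _ → 1)
  numPF≡∑park a b = trans (countTrue≡∑ (isPF k l) (allVecs a b))
    (trans (∑-cong (allVecs a b) (isPF≡parkWeight a b)) (∑-allVecs a b (parkWeight (candidates 1 b k l) (λ _ → 1) ∅)))

  isC≡parkWeight : ∀ a b (v : Vec (Fin b) a) → (if isC k l v then 1 else 0) ≡ parkWeight (candidates 0 b k l) (ifVacant 0 (λ _ → 1)) ∅ (prefs v)
  isC≡parkWeight a b v rewrite park≡run 0 b k l [] (prefs v) = outcome (run 0 b k l [] (prefs v)) refl
    where
    outcome : ∀ r → run 0 b k l [] (prefs v) ≡ r →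
      (if isPF k l v ∧ parksAvoiding0 r then 1 else 0) ≡ weight (ifVacant 0 (λ _ → 1)) (M.map occupancyOf r)
    outcome nothing _ = cong (λ z → if z then 1 else 0) (∧-zeroʳ (isPF k l v))
    outcome (just occ) eqr with occupied 0 occ in occ0
    ... | true = cong (λ z → if z then 1 else 0) (∧-zeroʳ (isPF k l v))
    ... | false = cong (λ z → if z then 1 else 0) (trans (∧-identityʳ (isPF k l v)) parks)
      where
      parks : isPF k l v ≡ true
      parks = begin
        isJust (run 1 b k l [] (prefs v))                                ≡⟨ isJust-map occupancyOf (run 1 b k l [] (prefs v)) ⟨
        isJust (M.map occupancyOf (run 1 b k l [] (prefs v)))            ≡⟨ cong isJust (park≡run 1 b k l [] (prefs v)) ⟨
        isJust (park (candidates 1 b k l) ∅ (prefs v))                   ≡⟨ cong isJust (park-avoiding-0 b ∅ (prefs v) (trans (park≡run 0 b k l [] (prefs v)) (cong (M.map occupancyOf) eqr)) occ0) ⟩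
        true                                                             ∎

  numC≡∑park : ∀ a b → numC k l a b ≡ ∑park 0 b a (ifVacant 0 (λ _ → 1))
  numC≡∑park a b = trans (countTrue≡∑ (isC k l) (allVecs a b))
    (trans (∑-cong (allVecs a b) (isC≡parkWeight a b)) (∑-allVecs a b (parkWeight (candidates 0 b k l) (ifVacant 0 (λ _ → 1)) ∅)))

-- Translating a street

back-shift : ∀ e a k → back e (e + a) k ≡ map (e +_) (back 0 a k)
back-shift e a zero = refl
back-shift e zero (suc k) rewrite +-identityʳ e = back-at-start e
  where
  back-at-start : ∀ e → back e e (suc k) ≡ []
  back-at-start zero = refl
  back-at-start (suc e) rewrite >⇒≤ᵇ≡false (suc e) e ≤-refl = refl
back-shift e (suc a) (suc k) rewrite +-suc e a | ≤⇒≤ᵇ≡true e (e + a) (m≤m+n e a) = cong (e + a ∷_) (back-shift e a k)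

+-≤ᵇ-∸ : ∀ e b a → e ≤ b → (suc (e + a) ≤ᵇ b) ≡ (suc a ≤ᵇ b ∸ e)
+-≤ᵇ-∸ zero b a _ = refl
+-≤ᵇ-∸ (suc e) (suc b) a (s≤s e≤b) = +-≤ᵇ-∸ e b a e≤b

fwd-shift : ∀ e b a l → e ≤ b → fwd b (e + a) l ≡ map (e +_) (fwd (b ∸ e) a l)
fwd-shift e b a zero _ = refl
fwd-shift e b a (suc l) e≤b rewrite +-≤ᵇ-∸ e b a e≤b with suc a ≤ᵇ b ∸ e
... | true = cong₂ _∷_ (sym (+-suc e a)) (trans (cong (λ z → fwd b z l) (sym (+-suc e a))) (fwd-shift e b (suc a) l e≤b))
... | false = refl

candidates-shift : ∀ k l e b a → e ≤ b → candidates e b k l (e + a) ≡ map (e +_) (candidates 0 (b ∸ e) k l a)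
candidates-shift k l e b a e≤b =
  cong (e + a ∷_) (trans (cong₂ _++_ (back-shift e a k) (fwd-shift e b a l e≤b)) (sym (map-++ (e +_) (back 0 a k) _)))

Shifted : ℕ → Occupancy → Occupancy → Set
Shifted e O P = ∀ t → O (e + t) ≡ P t

Shifted? : ℕ → Maybe Occupancy → Maybe Occupancy → Set
Shifted? e (just O) (just P) = Shifted e O P
Shifted? e nothing nothing = ⊤
Shifted? e _ _ = ⊥

Extensional : (Occupancy → ℕ) → Set
Extensional T = ∀ O P → (∀ t → O t ≡ P t) → T O ≡ T P

firstVacant-shift : ∀ O P e xs → Shifted e O P → firstVacant O (map (e +_) xs) ≡ M.map (e +_) (firstVacant P xs)
firstVacant-shift O P e [] O≈P = refl
firstVacant-shift O P e (x ∷ xs) O≈P rewrite O≈P x with P x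
... | true = firstVacant-shift O P e xs O≈P
... | false = refl

+-≡ᵇ-cancelˡ : ∀ e t s → (e + t ≡ᵇ e + s) ≡ (t ≡ᵇ s)
+-≡ᵇ-cancelˡ zero t s = refl
+-≡ᵇ-cancelˡ (suc e) t s = +-≡ᵇ-cancelˡ e t s

occupy-shift : ∀ O P e s → Shifted e O P → Shifted e (occupy O (e + s)) (occupy P s)
occupy-shift O P e s O≈P t rewrite +-≡ᵇ-cancelˡ e t s | O≈P t = refl

module _ (k l : ℕ) where
  park-shift : ∀ e b O P v → e ≤ b → Shifted e O P →
    Shifted? e (park (candidates e b k l) O (map (e +_) v)) (park (candidates 0 (b ∸ e) k l) P v)
  park-shift e b O P [] e≤b O≈P = O≈P
  park-shift e b O P (a ∷ v) e≤b O≈P =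
    step (firstVacant O (candidates e b k l (e + a))) (firstVacant P (candidates 0 (b ∸ e) k l a))
         (trans (cong (firstVacant O) (candidates-shift k l e b a e≤b)) (firstVacant-shift O P e (candidates 0 (b ∸ e) k l a) O≈P))
    where
    step : ∀ ms ms′ → ms ≡ M.map (e +_) ms′ →
      Shifted? e (park′ (candidates e b k l) (map (e +_) v) ms O) (park′ (candidates 0 (b ∸ e) k l) v ms′ P)
    step .nothing nothing refl = tt
    step .(just (e + s)) (just s) refl = park-shift e b (occupy O (e + s)) (occupy P s) v e≤b (occupy-shift O P e s O≈P)

  parkWeight-shift : ∀ e b v (T : Occupancy → ℕ) → e ≤ b → Extensional T →
    parkWeight (candidates e b k l) (ifVacant e (λ O → T (λ t → O (e + t)))) ∅ (map (e +_) v) ≡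
    parkWeight (candidates 0 (b ∸ e) k l) (ifVacant 0 T) ∅ v
  parkWeight-shift e b v T e≤b T-ext =
    outcome (park (candidates e b k l) ∅ (map (e +_) v)) (park (candidates 0 (b ∸ e) k l) ∅ v) (park-shift e b ∅ ∅ v e≤b (λ _ → refl))
    where
    outcome : ∀ r r′ → Shifted? e r r′ → weight (ifVacant e (λ O → T (λ t → O (e + t)))) r ≡ weight (ifVacant 0 T) r′
    outcome (just O) (just P) O≈P rewrite sym (trans (cong O (sym (+-identityʳ e))) (O≈P 0)) with O e
    ... | true = refl
    ... | false = T-ext _ P O≈P
    outcome nothing nothing _ = refl

  parkWeight-preferring : ∀ c e (T : Occupancy → ℕ) rest → c e ≡ e ∷ rest → ∀ O u v → parkWeight c (ifVacant e T) O (u ++ e ∷ v) ≡ 0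
  parkWeight-preferring c e T rest ce O [] v rewrite ce with O e in Oe
  ... | true = afterOccupied (firstVacant O rest)
    where
    afterOccupied : ∀ ms → weight (ifVacant e T) (park′ c v ms O) ≡ 0
    afterOccupied nothing = refl
    afterOccupied (just s) = parkWeight-occupied c e T (occupy O s) v (occupy-mono O s e Oe)
  ... | false = parkWeight-occupied c e T (occupy O e) v (occupy-self O e)
  parkWeight-preferring c e T rest ce O (a ∷ u) v with firstVacant O (c a)
  ... | nothing = refl
  ... | just s = parkWeight-preferring c e T rest ce (occupy O s) u v

  ∑park-separates : ∀ lo b e j (T1 T2 : Occupancy → ℕ) → lo ≤ e → e ≤ b → 1 ≤ e → DependsOn (_< e) T1 → Extensional T2 →
    ∑park k l lo b j (ifVacant e (λ O → T1 O * T2 (λ t → O (e + t)))) ≡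
    shuffle j (λ x → ∑park k l lo (e ∸ 1) x T1) (λ y → ∑park k l 0 (b ∸ e) y (ifVacant 0 T2))
  ∑park-separates lo b e j T1 T2 lo≤e e≤b 1≤e T1-dep T2-ext = begin
    ∑words j (spots 1 b) (wB ∅)                                   ≡⟨ cong (λ z → ∑words j z (wB ∅)) spots≡AL++AR ⟩
    ∑words j (AL ++ AR) (wB ∅)                                    ≡⟨ ∑words-cong j (AL ++ AR) (λ w → parkWeight-separates w ∅ refl) ⟩
    ∑words j (AL ++ AR) (λ w → wL ∅ (fL w) * wR ∅ (fR w))         ≡⟨ ∑words-separate (_<? e) AL AR AL-< AR-≥ j (wL ∅) (wR ∅) ⟩
    shuffle j (λ x → ∑words x AL (wL ∅)) (λ y → ∑words y AR (wR ∅))  ≡⟨ shuffle-cong j (λ _ → refl) right ⟩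
    shuffle j (λ x → ∑park k l lo (e ∸ 1) x T1) (λ y → ∑park k l 0 (b ∸ e) y (ifVacant 0 T2)) ∎
    where
    T2ₑ : Occupancy → ℕ
    T2ₑ O = T2 (λ t → O (e + t))
    T2ₑ-dep : DependsOn (e ≤_) T2ₑ
    T2ₑ-dep O P ag = T2-ext _ _ (λ t → ag (e + t) (m≤m+n e t))
    open Separation k l lo b e lo≤e e≤b 1≤e
    open Separation.Weights k l lo b e lo≤e e≤b 1≤e T1 T2ₑ T1-dep T2ₑ-dep
    AL AR : List ℕ
    AL = spots 1 (e ∸ 1)
    AR = spots e (suc (b ∸ e))
    spots≡AL++AR : spots 1 b ≡ AL ++ AR
    spots≡AL++AR = begin
      spots 1 b                                   ≡⟨ cong (spots 1) (sym length-AL++AR) ⟩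
      spots 1 ((e ∸ 1) + suc (b ∸ e))             ≡⟨ spots-++ 1 (e ∸ 1) (suc (b ∸ e)) ⟩
      AL ++ spots (1 + (e ∸ 1)) (suc (b ∸ e))     ≡⟨ cong (λ z → AL ++ spots z (suc (b ∸ e))) (m+[n∸m]≡n 1≤e) ⟩
      AL ++ AR                                    ∎
      where
      length-AL++AR : (e ∸ 1) + suc (b ∸ e) ≡ b
      length-AL++AR = trans (+-suc (e ∸ 1) (b ∸ e)) (trans (cong (_+ (b ∸ e)) (m+[n∸m]≡n 1≤e)) (m+[n∸m]≡n e≤b))
    AL-< : All (_< e) AL
    AL-< = All.map (λ {a} p → subst (a <_) (m+[n∸m]≡n 1≤e) (proj₂ p)) (spots-bounds 1 (e ∸ 1))
    AR-≥ : All (∁ (_< e)) AR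
    AR-≥ = All.map (λ p → ≤⇒≯ (proj₁ p)) (spots-bounds e (suc (b ∸ e)))
    right : ∀ y → ∑words y AR (wR ∅) ≡ ∑park k l 0 (b ∸ e) y (ifVacant 0 T2)
    right y = begin
      ∑words y (e ∷ spots (suc e) (b ∸ e)) (wR ∅)
        ≡⟨ ∑words-drop y e _ (wR ∅) (parkWeight-preferring (candidates e b k l) e T2ₑ _ refl ∅) ⟩
      ∑words y (spots (suc e) (b ∸ e)) (wR ∅)
        ≡⟨ cong (λ z → ∑words y z (wR ∅)) (trans (cong (λ z → spots z (b ∸ e)) (+-comm 1 e)) (spots-shift e 1 (b ∸ e))) ⟩
      ∑words y (map (e +_) (spots 1 (b ∸ e))) (wR ∅)
        ≡⟨ ∑words-map y (e +_) _ (wR ∅) ⟩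
      ∑words y (spots 1 (b ∸ e)) (λ v → wR ∅ (map (e +_) v))
        ≡⟨ ∑words-cong y _ (λ v → parkWeight-shift e b v T2 e≤b T2-ext) ⟩
      ∑park k l 0 (b ∸ e) y (ifVacant 0 T2) ∎

allOccupied : Occupancy → ℕ → ℕ → Bool
allOccupied O s zero = true
allOccupied O s (suc c) = O s ∧ allOccupied O (suc s) c

countOccupied : Occupancy → ℕ → ℕ → ℕ
countOccupied O s zero = 0
countOccupied O s (suc c) = χ (O s) + countOccupied O (suc s) c

countOccupied-≤ : ∀ O s c → countOccupied O s c ≤ c
countOccupied-≤ O s zero = z≤n
countOccupied-≤ O s (suc c) with O s
... | true = s≤s (countOccupied-≤ O (suc s) c)
... | false = m≤n⇒m≤1+n (countOccupied-≤ O (suc s) c)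

allOccupied≡countOccupied≡ᵇ : ∀ O s c → allOccupied O s c ≡ (countOccupied O s c ≡ᵇ c)
allOccupied≡countOccupied≡ᵇ O s zero = refl
allOccupied≡countOccupied≡ᵇ O s (suc c) with O s
... | true = allOccupied≡countOccupied≡ᵇ O (suc s) c
... | false = sym (≢⇒≡ᵇ≡false _ (suc c) (<⇒≢ (s≤s (countOccupied-≤ O (suc s) c))))

countOccupied-∅ : ∀ s c → countOccupied ∅ s c ≡ 0
countOccupied-∅ s zero = refl
countOccupied-∅ s (suc c) = countOccupied-∅ (suc s) c

countOccupied-occupy-< : ∀ O t s c → t < s → countOccupied (occupy O t) s c ≡ countOccupied O s c
countOccupied-occupy-< O t s zero _ = refl
countOccupied-occupy-< O t s (suc c) t<s rewrite ≢⇒≡ᵇ≡false s t (>⇒≢ t<s) =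
  cong (χ (O s) +_) (countOccupied-occupy-< O t (suc s) c (m<n⇒m<1+n t<s))

countOccupied-occupy : ∀ O t s c → O t ≡ false → s ≤ t → t < s + c → countOccupied (occupy O t) s c ≡ suc (countOccupied O s c)
countOccupied-occupy O t s zero Ot s≤t t<s+0 = ⊥-elim (<⇒≱ t<s+0 (subst (_≤ t) (sym (+-identityʳ s)) s≤t))
countOccupied-occupy O t s (suc c) Ot s≤t t<s+c with s ≟ t
... | yes refl rewrite ≡ᵇ-refl s | Ot = cong suc (countOccupied-occupy-< O s (suc s) c ≤-refl)
... | no s≢t rewrite ≢⇒≡ᵇ≡false s t s≢t =
  trans (cong (χ (O s) +_) (countOccupied-occupy O t (suc s) c Ot (≤∧≢⇒< s≤t s≢t) (subst (t <_) (+-suc s c) t<s+c)))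
        (+-suc (χ (O s)) _)

allOccupied-agree : ∀ O P s c → (∀ t → s ≤ t → t < s + c → O t ≡ P t) → allOccupied O s c ≡ allOccupied P s c
allOccupied-agree O P s zero O≈P = refl
allOccupied-agree O P s (suc c) O≈P = cong₂ _∧_ (O≈P s ≤-refl (subst (s <_) (sym (+-suc s c)) (s≤s (m≤m+n s c))))
  (allOccupied-agree O P (suc s) c (λ t p q → O≈P t (≤-trans (n≤1+n s) p) (subst (t <_) (sym (+-suc s c)) q)))

allOccupied-shift : ∀ O e s c → allOccupied O (e + s) c ≡ allOccupied (λ t → O (e + t)) s c
allOccupied-shift O e s zero = refl
allOccupied-shift O e s (suc c) =
  cong (O (e + s) ∧_) (trans (cong (λ z → allOccupied O z c) (sym (+-suc e s))) (allOccupied-shift O e (suc s) c))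

weight-cong : ∀ {T T′ : Occupancy → ℕ} → (∀ O → T O ≡ T′ O) → ∀ r → weight T r ≡ weight T′ r
weight-cong T≗T′ nothing = refl
weight-cong T≗T′ (just O) = T≗T′ O

∑words-χ-length : ∀ r R A (F : List ℕ → ℕ) → ∑words r A (λ w → χ (length w ≡ᵇ R) * F w) ≡ (if r ≡ᵇ R then ∑words r A F else 0)
∑words-χ-length r R A F = begin
  ∑words r A (λ w → χ (length w ≡ᵇ R) * F w)   ≡⟨ ∑words-length r A (λ n w → χ (n ≡ᵇ R) * F w) ⟩
  ∑words r A (λ w → χ (r ≡ᵇ R) * F w)          ≡⟨ ∑-*ˡ (words r A) (χ (r ≡ᵇ R)) F ⟩
  χ (r ≡ᵇ R) * ∑words r A F                    ≡⟨ χ-* (r ≡ᵇ R) ⟩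
  (if r ≡ᵇ R then ∑words r A F else 0)         ∎
  where
  χ-* : ∀ b → χ b * ∑words r A F ≡ (if b then ∑words r A F else 0)
  χ-* true = +-identityʳ _
  χ-* false = refl

if-≡ᵇ : ∀ r R (f : ℕ → ℕ) → (if r ≡ᵇ R then f r else 0) ≡ (if r ≡ᵇ R then f R else 0)
if-≡ᵇ r R f with r ≡ᵇ R in r≡ᵇR
... | true = cong f (≡ᵇ≡true⇒≡ r R r≡ᵇR)
... | false = refl

module _ (k l : ℕ) where
  candidates-within : ∀ lo R a → lo ≤ a → a ≤ R → All (λ t → lo ≤ t × t ≤ R) (candidates lo R k l a)
  candidates-within lo R a lo≤a a≤R = (lo≤a , a≤R) ∷ ++⁺
    (All.zip (back-≥ lo a k , All.map (λ t<a → ≤-trans (<⇒≤ t<a) a≤R) (back-< lo a k)))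
    (All.zip (All.map (λ a<t → ≤-trans lo≤a (<⇒≤ a<t)) (fwd-> R a l) , fwd-≤ R a l))

  spots-within : ∀ lo R → lo ≤ 1 → All (λ a → lo ≤ a × a ≤ R) (spots 1 R)
  spots-within lo R lo≤1 = All.map (λ p → ≤-trans lo≤1 (proj₁ p) , ≤-pred (proj₂ p)) (spots-bounds 1 R)

  countOccupied-park : ∀ lo R O w {O′} → park (candidates lo R k l) O w ≡ just O′ → All (λ a → lo ≤ a × a ≤ R) w →
    countOccupied O′ lo (suc R ∸ lo) ≡ length w + countOccupied O lo (suc R ∸ lo)
  countOccupied-park lo R O [] refl _ = refl
  countOccupied-park lo R O (a ∷ w) {O′} r (a-in ∷ w-in) = step (firstVacant O (candidates lo R k l a)) refl r
    where
    step : ∀ ms → firstVacant O (candidates lo R k l a) ≡ ms → park′ (candidates lo R k l) w ms O ≡ just O′ →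
      countOccupied O′ lo (suc R ∸ lo) ≡ suc (length w + countOccupied O lo (suc R ∸ lo))
    step (just t) eq r′ = begin
      countOccupied O′ lo (suc R ∸ lo)                          ≡⟨ countOccupied-park lo R (occupy O t) w r′ w-in ⟩
      length w + countOccupied (occupy O t) lo (suc R ∸ lo)     ≡⟨ cong (length w +_) (countOccupied-occupy O t lo (suc R ∸ lo) (firstVacant-vacant O (candidates lo R k l a) eq) (proj₁ t-in) t<) ⟩
      length w + suc (countOccupied O lo (suc R ∸ lo))          ≡⟨ +-suc (length w) _ ⟩
      suc (length w + countOccupied O lo (suc R ∸ lo))          ∎
      where
      t-in = firstVacant-All O (candidates lo R k l a) (candidates-within lo R a (proj₁ a-in) (proj₂ a-in)) eq
      t< : t < lo + (suc R ∸ lo)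
      t< = subst (t <_) (sym (m+[n∸m]≡n (≤-trans (proj₁ t-in) (≤-trans (proj₂ t-in) (n≤1+n R))))) (s≤s (proj₂ t-in))

  ∑park-cong : ∀ lo b j {T T′ : Occupancy → ℕ} → (∀ O → T O ≡ T′ O) → ∑park k l lo b j T ≡ ∑park k l lo b j T′
  ∑park-cong lo b j T≗T′ = ∑words-cong j _ (λ w → weight-cong T≗T′ (park (candidates lo b k l) ∅ w))

  ∑park-fullC : ∀ R r → ∑park k l 0 R r (ifVacant 0 (λ O → χ (allOccupied O 1 R))) ≡ (if r ≡ᵇ R then numC k l R R else 0)
  ∑park-fullC R r = begin
    ∑words r (spots 1 R) (parkWeight c0 (ifVacant 0 (λ O → χ (allOccupied O 1 R))) ∅)
      ≡⟨ ∑words-congAll _ r _ (spots-within 0 R z≤n) full⇔length≡R ⟩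
    ∑words r (spots 1 R) (λ w → χ (length w ≡ᵇ R) * parkWeight c0 (ifVacant 0 (λ _ → 1)) ∅ w)
      ≡⟨ ∑words-χ-length r R (spots 1 R) _ ⟩
    (if r ≡ᵇ R then ∑park k l 0 R r (ifVacant 0 (λ _ → 1)) else 0)
      ≡⟨ cong (λ x → if r ≡ᵇ R then x else 0) (sym (numC≡∑park k l r R)) ⟩
    (if r ≡ᵇ R then numC k l r R else 0)
      ≡⟨ if-≡ᵇ r R (λ r → numC k l r R) ⟩
    (if r ≡ᵇ R then numC k l R R else 0) ∎
    where
    c0 = candidates 0 R k l
    full⇔length≡R : ∀ w → All (λ a → 0 ≤ a × a ≤ R) w →
      parkWeight c0 (ifVacant 0 (λ O → χ (allOccupied O 1 R))) ∅ w ≡ χ (length w ≡ᵇ R) * parkWeight c0 (ifVacant 0 (λ _ → 1)) ∅ w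
    full⇔length≡R w w-in with park c0 ∅ w in eq
    ... | nothing = sym (*-zeroʳ (χ (length w ≡ᵇ R)))
    ... | just O with O 0 in O0
    ...   | true = sym (*-zeroʳ (χ (length w ≡ᵇ R)))
    ...   | false = trans (cong χ (trans (allOccupied≡countOccupied≡ᵇ O 1 R) (cong (_≡ᵇ R) count≡length))) (sym (*-identityʳ _))
      where
      count≡length : countOccupied O 1 R ≡ length w
      count≡length = begin
        countOccupied O 1 R                 ≡⟨ cong (λ z → χ z + countOccupied O 1 R) O0 ⟨
        countOccupied O 0 (suc R)           ≡⟨ countOccupied-park 0 R ∅ w eq w-in ⟩
        length w + countOccupied ∅ 0 (suc R) ≡⟨ cong (length w +_) (countOccupied-∅ 0 (suc R)) ⟩
        length w + 0                        ≡⟨ +-identityʳ _ ⟩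
        length w                            ∎

  ∑park-fullPF : ∀ R r → ∑park k l 1 R r (λ O → χ (allOccupied O 1 R)) ≡ (if r ≡ᵇ R then numPF k l R R else 0)
  ∑park-fullPF R r = begin
    ∑words r (spots 1 R) (parkWeight c1 (λ O → χ (allOccupied O 1 R)) ∅)
      ≡⟨ ∑words-congAll _ r _ (spots-within 1 R ≤-refl) full⇔length≡R ⟩
    ∑words r (spots 1 R) (λ w → χ (length w ≡ᵇ R) * parkWeight c1 (λ _ → 1) ∅ w)
      ≡⟨ ∑words-χ-length r R (spots 1 R) _ ⟩
    (if r ≡ᵇ R then ∑park k l 1 R r (λ _ → 1) else 0)
      ≡⟨ cong (λ x → if r ≡ᵇ R then x else 0) (sym (numPF≡∑park k l r R)) ⟩
    (if r ≡ᵇ R then numPF k l r R else 0)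
      ≡⟨ if-≡ᵇ r R (λ r → numPF k l r R) ⟩
    (if r ≡ᵇ R then numPF k l R R else 0) ∎
    where
    c1 = candidates 1 R k l
    full⇔length≡R : ∀ w → All (λ a → 1 ≤ a × a ≤ R) w →
      parkWeight c1 (λ O → χ (allOccupied O 1 R)) ∅ w ≡ χ (length w ≡ᵇ R) * parkWeight c1 (λ _ → 1) ∅ w
    full⇔length≡R w w-in with park c1 ∅ w in eq
    ... | nothing = sym (*-zeroʳ (χ (length w ≡ᵇ R)))
    ... | just O = trans (cong χ (trans (allOccupied≡countOccupied≡ᵇ O 1 R) (cong (_≡ᵇ R) count≡length))) (sym (*-identityʳ _))
      where
      count≡length : countOccupied O 1 R ≡ length w
      count≡length = trans (countOccupied-park 1 R ∅ w eq w-in) (trans (cong (length w +_) (countOccupied-∅ 1 R)) (+-identityʳ _))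

module _ (k l : ℕ) where
  fullThenVacant : ℕ → Occupancy → ℕ
  fullThenVacant R P = χ (allOccupied P 1 R) * χ (not (P (suc R)))

  fullThenVacant-ext : ∀ R → Extensional (fullThenVacant R)
  fullThenVacant-ext R O P O≗P = cong₂ _*_ (cong χ (allOccupied-agree O P 1 R (λ t _ _ → O≗P t))) (cong (χ ∘ not) (O≗P (suc R)))

  ∑park-C-fullThenVacant : ∀ N R y → suc R ≤ N →
    ∑park k l 0 N y (ifVacant 0 (fullThenVacant R)) ≡ (y C R) * numC k l R R * numC k l (y ∸ R) (N ∸ suc R)
  ∑park-C-fullThenVacant N R y R<N = begin
    ∑park k l 0 N y (ifVacant 0 (fullThenVacant R))
      ≡⟨ ∑park-cong k l 0 N y vacant-at-1+R ⟩
    ∑park k l 0 N y (ifVacant (suc R) (λ P → T1 P * 1))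
      ≡⟨ ∑park-separates k l 0 N (suc R) y T1 (λ _ → 1) z≤n R<N (s≤s z≤n) T1-dep (λ _ _ _ → refl) ⟩
    shuffle y (λ r → ∑park k l 0 R r T1) (λ t → ∑park k l 0 (N ∸ suc R) t (ifVacant 0 (λ _ → 1)))
      ≡⟨ shuffle-cong y (∑park-fullC k l R) (λ t → sym (numC≡∑park k l t (N ∸ suc R))) ⟩
    shuffle y (λ r → if r ≡ᵇ R then numC k l R R else 0) (λ t → numC k l t (N ∸ suc R))
      ≡⟨ shuffle-δˡ y R _ _ ⟩
    (y C R) * numC k l R R * numC k l (y ∸ R) (N ∸ suc R) ∎
    where
    T1 : Occupancy → ℕ
    T1 = ifVacant 0 (λ P → χ (allOccupied P 1 R))
    T1-dep : DependsOn (_< suc R) T1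
    T1-dep O P ag rewrite ag 0 (s≤s z≤n) with P 0
    ... | true = refl
    ... | false = cong χ (allOccupied-agree O P 1 R (λ t _ t≤R → ag t t≤R))
    vacant-at-1+R : ∀ P → ifVacant 0 (fullThenVacant R) P ≡ ifVacant (suc R) (λ P → T1 P * 1) P
    vacant-at-1+R P with P 0 | P (suc R)
    ... | true | true = refl
    ... | true | false = refl
    ... | false | true = *-zeroʳ (χ (allOccupied P 1 R))
    ... | false | false = refl

  ∑park-vacant : ∀ b e j (T : Occupancy → ℕ) → 1 ≤ e → e ≤ b → Extensional T →
    ∑park k l 1 b j (ifVacant e (λ O → T (λ t → O (e + t)))) ≡
    shuffle j (λ x → numPF k l x (e ∸ 1)) (λ y → ∑park k l 0 (b ∸ e) y (ifVacant 0 T))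
  ∑park-vacant b e j T 1≤e e≤b T-ext = begin
    ∑park k l 1 b j (ifVacant e (λ O → T (λ t → O (e + t))))
      ≡⟨ ∑park-cong k l 1 b j (λ O → cong (λ x → if O e then 0 else x) (sym (+-identityʳ _))) ⟩
    ∑park k l 1 b j (ifVacant e (λ O → 1 * T (λ t → O (e + t))))
      ≡⟨ ∑park-separates k l 1 b e j (λ _ → 1) T 1≤e e≤b 1≤e (λ _ _ _ → refl) T-ext ⟩
    shuffle j (λ x → ∑park k l 1 (e ∸ 1) x (λ _ → 1)) (λ y → ∑park k l 0 (b ∸ e) y (ifVacant 0 T))
      ≡⟨ shuffle-cong j (λ x → sym (numPF≡∑park k l x (e ∸ 1))) (λ _ → refl) ⟩
    shuffle j (λ x → numPF k l x (e ∸ 1)) (λ y → ∑park k l 0 (b ∸ e) y (ifVacant 0 T)) ∎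

  ∑park-vacant-Z : ∀ b e j → 1 ≤ e → e ≤ b →
    ∑park k l 1 b j (ifVacant e (λ _ → 1)) ≡ shuffle j (λ x → numPF k l x (e ∸ 1)) (λ y → numC k l y (b ∸ e))
  ∑park-vacant-Z b e j 1≤e e≤b =
    trans (∑park-vacant b e j (λ _ → 1) 1≤e e≤b (λ _ _ _ → refl))
          (shuffle-cong j (λ _ → refl) (λ y → sym (numC≡∑park k l y (b ∸ e))))

  ∑park-vacant-V : ∀ b e R j → 1 ≤ e → e + suc R ≤ b →
    ∑park k l 1 b j (ifVacant e (λ O → χ (allOccupied O (e + 1) R) * χ (not (O (e + suc R))))) ≡
    shuffle j (λ x → numPF k l x (e ∸ 1)) (λ y → (y C R) * numC k l R R * numC k l (y ∸ R) (b ∸ e ∸ suc R))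
  ∑park-vacant-V b e R j 1≤e e+R<b = begin
    ∑park k l 1 b j (ifVacant e (λ O → χ (allOccupied O (e + 1) R) * χ (not (O (e + suc R)))))
      ≡⟨ ∑park-cong k l 1 b j (λ O → cong (λ x → if O e then 0 else χ x * χ (not (O (e + suc R)))) (allOccupied-shift O e 1 R)) ⟩
    ∑park k l 1 b j (ifVacant e (λ O → fullThenVacant R (λ t → O (e + t))))
      ≡⟨ ∑park-vacant b e j (fullThenVacant R) 1≤e (≤-trans (m≤m+n e (suc R)) e+R<b) (fullThenVacant-ext R) ⟩
    shuffle j (λ x → numPF k l x (e ∸ 1)) (λ y → ∑park k l 0 (b ∸ e) y (ifVacant 0 (fullThenVacant R)))
      ≡⟨ shuffle-cong j (λ _ → refl) (λ y → ∑park-C-fullThenVacant (b ∸ e) R y (m+n≤o⇒m≤o∸n (suc R) (subst (_≤ b) (+-comm e (suc R)) e+R<b))) ⟩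
    shuffle j (λ x → numPF k l x (e ∸ 1)) (λ y → (y C R) * numC k l R R * numC k l (y ∸ R) (b ∸ e ∸ suc R)) ∎

  ∑park-vacant-X : ∀ b e j → 1 ≤ e → e ≤ b →
    ∑park k l 1 b j (ifVacant e (λ O → χ (allOccupied O (e + 1) (b ∸ e)))) ≡
    shuffle j (λ x → numPF k l x (e ∸ 1)) (λ y → if y ≡ᵇ (b ∸ e) then numC k l (b ∸ e) (b ∸ e) else 0)
  ∑park-vacant-X b e j 1≤e e≤b = begin
    ∑park k l 1 b j (ifVacant e (λ O → χ (allOccupied O (e + 1) (b ∸ e))))
      ≡⟨ ∑park-cong k l 1 b j (λ O → cong (λ x → if O e then 0 else χ x) (allOccupied-shift O e 1 (b ∸ e))) ⟩
    ∑park k l 1 b j (ifVacant e (λ O → T (λ t → O (e + t))))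
      ≡⟨ ∑park-vacant b e j T 1≤e e≤b (λ O P O≗P → cong χ (allOccupied-agree O P 1 (b ∸ e) (λ t _ _ → O≗P t))) ⟩
    shuffle j (λ x → numPF k l x (e ∸ 1)) (λ y → ∑park k l 0 (b ∸ e) y (ifVacant 0 T))
      ≡⟨ shuffle-cong j (λ _ → refl) (∑park-fullC k l (b ∸ e)) ⟩
    shuffle j (λ x → numPF k l x (e ∸ 1)) (λ y → if y ≡ᵇ (b ∸ e) then numC k l (b ∸ e) (b ∸ e) else 0) ∎
    where
    T : Occupancy → ℕ
    T P = χ (allOccupied P 1 (b ∸ e))

  ∑park-vacant-Y : ∀ b e j → 1 ≤ e → e ≤ b →
    ∑park k l 1 b j (ifVacant e (λ O → χ (allOccupied O 1 (e ∸ 1)))) ≡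
    shuffle j (λ x → if x ≡ᵇ (e ∸ 1) then numPF k l (e ∸ 1) (e ∸ 1) else 0) (λ y → numC k l y (b ∸ e))
  ∑park-vacant-Y b e j 1≤e e≤b = begin
    ∑park k l 1 b j (ifVacant e T)
      ≡⟨ ∑park-cong k l 1 b j (λ O → cong (λ x → if O e then 0 else x) (sym (*-identityʳ _))) ⟩
    ∑park k l 1 b j (ifVacant e (λ O → T O * 1))
      ≡⟨ ∑park-separates k l 1 b e j T (λ _ → 1) 1≤e e≤b 1≤e T-dep (λ _ _ _ → refl) ⟩
    shuffle j (λ x → ∑park k l 1 (e ∸ 1) x T) (λ y → ∑park k l 0 (b ∸ e) y (ifVacant 0 (λ _ → 1)))
      ≡⟨ shuffle-cong j (∑park-fullPF k l (e ∸ 1)) (λ y → sym (numC≡∑park k l y (b ∸ e))) ⟩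
    shuffle j (λ x → if x ≡ᵇ (e ∸ 1) then numPF k l (e ∸ 1) (e ∸ 1) else 0) (λ y → numC k l y (b ∸ e)) ∎
    where
    T : Occupancy → ℕ
    T O = χ (allOccupied O 1 (e ∸ 1))
    T-dep : DependsOn (_< e) T
    T-dep O P ag = cong χ (allOccupied-agree O P 1 (e ∸ 1) (λ t _ t<e → ag t (subst (t <_) (m+[n∸m]≡n 1≤e) t<e)))

-- Which preferences send a car to a given vacant spot

landsOn : Maybe ℕ → ℕ → ℕ
landsOn nothing i = 0
landsOn (just s) i = χ (s ≡ᵇ i)

reaches : Occupancy → ℕ → List ℕ → Bool
reaches O i [] = false
reaches O i (x ∷ xs) = if x ≡ᵇ i then true else (O x ∧ reaches O i xs)

allOccupiedBelow : Occupancy → ℕ → ℕ → Bool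
allOccupiedBelow O s zero = true
allOccupiedBelow O s (suc c) = O (s ∸ 1) ∧ allOccupiedBelow O (s ∸ 1) c

run↑ : Occupancy → ℕ → ℕ → ℕ
run↑ O s zero = 0
run↑ O s (suc c) = if O s then suc (run↑ O (suc s) c) else 0

run↓ : Occupancy → ℕ → ℕ → ℕ
run↓ O s zero = 0
run↓ O s (suc c) = if O (s ∸ 1) then suc (run↓ O (s ∸ 1) c) else 0

χ-∧ : ∀ x y → χ (x ∧ y) ≡ χ x * χ y
χ-∧ true y = sym (+-identityʳ (χ y))
χ-∧ false y = refl

landsOn-firstVacant : ∀ O i xs → O i ≡ false → landsOn (firstVacant O xs) i ≡ χ (reaches O i xs)
landsOn-firstVacant O i [] Oi = refl
landsOn-firstVacant O i (x ∷ xs) Oi with x ≡ᵇ i in x≡ᵇi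
... | true rewrite ≡ᵇ≡true⇒≡ x i x≡ᵇi | Oi = cong χ (≡ᵇ-refl i)
... | false with O x
...   | true = landsOn-firstVacant O i xs Oi
...   | false = cong χ x≡ᵇi

landsOn-occupied : ∀ O i xs → O i ≡ true → landsOn (firstVacant O xs) i ≡ 0
landsOn-occupied O i xs Oi with firstVacant O xs in eq
... | nothing = refl
... | just s with s ≟ i
...   | yes refl = ⊥-elim (true≢false (trans (sym Oi) (firstVacant-vacant O xs eq)))
...   | no s≢i rewrite ≢⇒≡ᵇ≡false s i s≢i = refl

reaches-++ : ∀ O i xs ys → All (_≢ i) xs → reaches O i (xs ++ ys) ≡ all O xs ∧ reaches O i ys
reaches-++ O i [] ys [] = refl
reaches-++ O i (x ∷ xs) ys (x≢i ∷ xs≢i) rewrite ≢⇒≡ᵇ≡false x i x≢i | reaches-++ O i xs ys xs≢i =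
  sym (∧-assoc (O x) (all O xs) (reaches O i ys))

reaches-∉ : ∀ O i xs → All (_≢ i) xs → reaches O i xs ≡ false
reaches-∉ O i [] [] = refl
reaches-∉ O i (x ∷ xs) (x≢i ∷ xs≢i) rewrite ≢⇒≡ᵇ≡false x i x≢i | reaches-∉ O i xs xs≢i = ∧-zeroʳ (O x)

allOccupied-snoc : ∀ O s c → allOccupied O s (suc c) ≡ allOccupied O s c ∧ O (s + c)
allOccupied-snoc O s zero rewrite +-identityʳ s = ∧-identityʳ (O s)
allOccupied-snoc O s (suc c) rewrite allOccupied-snoc O (suc s) c | +-suc s c = sym (∧-assoc (O s) _ _)

allOccupiedBelow-+ : ∀ O s p q → allOccupiedBelow O s (p + q) ≡ allOccupiedBelow O s p ∧ allOccupiedBelow O (s ∸ p) q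
allOccupiedBelow-+ O s zero q = refl
allOccupiedBelow-+ O s (suc p) q rewrite allOccupiedBelow-+ O (s ∸ 1) p q | ∸-+-assoc s 1 p = sym (∧-assoc (O (s ∸ 1)) _ _)

allOccupied≡allOccupiedBelow : ∀ O s c → allOccupied O s c ≡ allOccupiedBelow O (s + c) c
allOccupied≡allOccupiedBelow O s zero = refl
allOccupied≡allOccupiedBelow O s (suc c) = begin
  O s ∧ allOccupied O (suc s) c
    ≡⟨ cong (O s ∧_) (allOccupied≡allOccupiedBelow O (suc s) c) ⟩
  O s ∧ allOccupiedBelow O (suc s + c) c
    ≡⟨ ∧-comm (O s) _ ⟩
  allOccupiedBelow O (suc s + c) c ∧ O s
    ≡⟨ cong (allOccupiedBelow O (suc s + c) c ∧_) (∧-identityʳ (O s)) ⟨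
  allOccupiedBelow O (suc s + c) c ∧ allOccupiedBelow O (suc s) 1
    ≡⟨ cong (λ z → allOccupiedBelow O (suc s + c) c ∧ allOccupiedBelow O z 1) (sym (m+n∸n≡m (suc s) c)) ⟩
  allOccupiedBelow O (suc s + c) c ∧ allOccupiedBelow O (suc s + c ∸ c) 1
    ≡⟨ allOccupiedBelow-+ O (suc s + c) c 1 ⟨
  allOccupiedBelow O (suc s + c) (c + 1)
    ≡⟨ cong₂ (allOccupiedBelow O) (sym (+-suc s c)) (+-comm c 1) ⟩
  allOccupiedBelow O (s + suc c) (suc c) ∎

<ᵇ-suc : ∀ d r → (d <ᵇ suc r) ≡ (d ≤ᵇ r)
<ᵇ-suc zero r = refl
<ᵇ-suc (suc d) r = refl

run↑-≤ : ∀ O s c → run↑ O s c ≤ c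
run↑-≤ O s zero = z≤n
run↑-≤ O s (suc c) with O s
... | true = s≤s (run↑-≤ O (suc s) c)
... | false = z≤n

run↓-≤ : ∀ O s c → run↓ O s c ≤ c
run↓-≤ O s zero = z≤n
run↓-≤ O s (suc c) with O (s ∸ 1)
... | true = s≤s (run↓-≤ O (s ∸ 1) c)
... | false = z≤n

allOccupied≡≤ᵇrun↑ : ∀ O s c d → d ≤ c → allOccupied O s d ≡ (d ≤ᵇ run↑ O s c)
allOccupied≡≤ᵇrun↑ O s c zero _ = refl
allOccupied≡≤ᵇrun↑ O s (suc c) (suc d) (s≤s d≤c) with O s
... | true = trans (allOccupied≡≤ᵇrun↑ O (suc s) c d d≤c) (sym (<ᵇ-suc d _))
... | false = refl

allOccupiedBelow≡≤ᵇrun↓ : ∀ O s c d → d ≤ c → allOccupiedBelow O s d ≡ (d ≤ᵇ run↓ O s c)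
allOccupiedBelow≡≤ᵇrun↓ O s c zero _ = refl
allOccupiedBelow≡≤ᵇrun↓ O s (suc c) (suc d) (s≤s d≤c) with O (s ∸ 1)
... | true = trans (allOccupiedBelow≡≤ᵇrun↓ O (s ∸ 1) c d d≤c) (sym (<ᵇ-suc d _))
... | false = refl

run↑≡ᵇ : ∀ O s c R → R < c → (run↑ O s c ≡ᵇ R) ≡ (allOccupied O s R ∧ not (O (s + R)))
run↑≡ᵇ O s (suc c) zero _ rewrite +-identityʳ s with O s
... | true = refl
... | false = refl
run↑≡ᵇ O s (suc c) (suc R) (s≤s R<c) with O s
... | true = trans (run↑≡ᵇ O (suc s) c R R<c) (cong (λ z → allOccupied O (suc s) R ∧ not (O z)) (sym (+-suc s R)))
... | false = refl

run↑≡ᵇmax : ∀ O s c → (run↑ O s c ≡ᵇ c) ≡ allOccupied O s c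
run↑≡ᵇmax O s zero = refl
run↑≡ᵇmax O s (suc c) with O s
... | true = run↑≡ᵇmax O (suc s) c
... | false = refl

run↓≡ᵇ : ∀ O s c L → L < c → (run↓ O s c ≡ᵇ L) ≡ (allOccupiedBelow O s L ∧ not (O (s ∸ suc L)))
run↓≡ᵇ O s (suc c) zero _ with O (s ∸ 1)
... | true = refl
... | false = refl
run↓≡ᵇ O s (suc c) (suc L) (s≤s L<c) with O (s ∸ 1)
... | true = trans (run↓≡ᵇ O (s ∸ 1) c L L<c) (cong (λ z → allOccupiedBelow O (s ∸ 1) L ∧ not (O z)) (∸-+-assoc s 1 (suc L)))
... | false = refl

run↓≡ᵇmax : ∀ O s c → (run↓ O s c ≡ᵇ c) ≡ allOccupiedBelow O s c
run↓≡ᵇmax O s zero = refl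
run↓≡ᵇmax O s (suc c) with O (s ∸ 1)
... | true = run↓≡ᵇmax O (s ∸ 1) c
... | false = refl

module _ (k l n : ℕ) where
  reaches-back : ∀ O i F → 1 ≤ i → All (_≢ i) F → ∀ j k′ →
    reaches O i (back 1 (i + 1 + j) k′ ++ F) ≡ (j <ᵇ k′) ∧ allOccupied O (i + 1) j
  reaches-back O i F 1≤i F≢i j zero = reaches-∉ O i F F≢i
  reaches-back O i F 1≤i F≢i zero (suc k′) rewrite +-identityʳ (i + 1) | +-comm i 1 | ≤⇒≤ᵇ≡true 1 i 1≤i | ≡ᵇ-refl i = refl
  reaches-back O i F 1≤i F≢i (suc j) (suc k′)
    rewrite +-suc (i + 1) j | ≤⇒≤ᵇ≡true 1 (i + 1 + j) (≤-trans 1≤i (≤-trans (m≤m+n i 1) (m≤m+n (i + 1) j)))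
          | ≢⇒≡ᵇ≡false (i + 1 + j) i (>⇒≢ (≤-trans (≤-reflexive (+-comm 1 i)) (m≤m+n (i + 1) j)))
          | reaches-back O i F 1≤i F≢i j k′ | allOccupied-snoc O (i + 1) j =
    ∧.x∙yz≈y∙zx (O (i + 1 + j)) (j <ᵇ k′) (allOccupied O (i + 1) j)

  landsOn-from-right : ∀ O i j → 1 ≤ i → O i ≡ false →
    landsOn (firstVacant O (candidates 1 n k l (i + 1 + j))) i ≡ χ (j <ᵇ k) * χ (allOccupied O (i + 1) (suc j))
  landsOn-from-right O i j 1≤i Oi = begin
    landsOn (firstVacant O (candidates 1 n k l a)) i   ≡⟨ landsOn-firstVacant O i (candidates 1 n k l a) Oi ⟩
    χ (reaches O i (candidates 1 n k l a))             ≡⟨ cong χ reaches-a ⟩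
    χ ((j <ᵇ k) ∧ allOccupied O (i + 1) (suc j))       ≡⟨ χ-∧ (j <ᵇ k) _ ⟩
    χ (j <ᵇ k) * χ (allOccupied O (i + 1) (suc j))     ∎
    where
    a = i + 1 + j
    i<a : i < a
    i<a = ≤-trans (≤-reflexive (+-comm 1 i)) (m≤m+n (i + 1) j)
    fwd≢i : All (_≢ i) (fwd n a l)
    fwd≢i = All.map (λ a<t → >⇒≢ (<-trans i<a a<t)) (fwd-> n a l)
    reaches-a : reaches O i (candidates 1 n k l a) ≡ (j <ᵇ k) ∧ allOccupied O (i + 1) (suc j)
    reaches-a rewrite ≢⇒≡ᵇ≡false a i (>⇒≢ i<a) | reaches-back O i (fwd n a l) 1≤i fwd≢i j k | allOccupied-snoc O (i + 1) j =
      ∧.x∙yz≈y∙zx (O a) (j <ᵇ k) (allOccupied O (i + 1) j)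

  reaches-fwd : ∀ O a j l′ → suc (a + j) ≤ n → reaches O (suc (a + j)) (fwd n a l′) ≡ (j <ᵇ l′) ∧ allOccupied O (suc a) j
  reaches-fwd O a j zero _ = refl
  reaches-fwd O a zero (suc l′) a<n rewrite +-identityʳ a | ≤⇒≤ᵇ≡true (suc a) n a<n | ≡ᵇ-refl a = refl
  reaches-fwd O a (suc j) (suc l′) a+j<n
    rewrite +-suc a j | ≤⇒≤ᵇ≡true (suc a) n (≤-trans (s≤s (m≤m+n a j)) (≤-trans (n≤1+n _) a+j<n))
          | ≢⇒≡ᵇ≡false a (suc (a + j)) (<⇒≢ (s≤s (m≤m+n a j)))
          | reaches-fwd O (suc a) j l′ a+j<n =
    ∧.x∙yz≈y∙xz (O (suc a)) (j <ᵇ l′) (allOccupied O (suc (suc a)) j)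

  all-back : ∀ O a k′ → all O (back 1 a k′) ≡ allOccupiedBelow O a (k′ ⊓ (a ∸ 1))
  all-back O a zero = refl
  all-back O zero (suc k′) = refl
  all-back O (suc zero) (suc k′) = refl
  all-back O (suc (suc a)) (suc k′) = cong (O (suc a) ∧_) (all-back O (suc a) k′)

  landsOn-from-left : ∀ O a j M → a + j ≡ M → 1 ≤ a → suc M ≤ n → O (suc M) ≡ false →
    landsOn (firstVacant O (candidates 1 n k l a)) (suc M) ≡ χ (j <ᵇ l) * χ (allOccupiedBelow O (suc M) (suc j + k ⊓ (a ∸ 1)))
  landsOn-from-left O a j .(a + j) refl 1≤a i≤n Oi = begin
    landsOn (firstVacant O (candidates 1 n k l a)) i   ≡⟨ landsOn-firstVacant O i (candidates 1 n k l a) Oi ⟩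
    χ (reaches O i (candidates 1 n k l a))             ≡⟨ cong χ reaches-i ⟩
    χ ((j <ᵇ l) ∧ allOccupiedBelow O i (suc j + K))    ≡⟨ χ-∧ (j <ᵇ l) _ ⟩
    χ (j <ᵇ l) * χ (allOccupiedBelow O i (suc j + K))  ∎
    where
    i = suc (a + j)
    K = k ⊓ (a ∸ 1)
    a<i : a < i
    a<i = s≤s (m≤m+n a j)
    back≢i : All (_≢ i) (back 1 a k)
    back≢i = All.map (λ t<a → <⇒≢ (<-trans t<a a<i)) (back-< 1 a k)
    below-i : allOccupiedBelow O i (suc j + K) ≡ allOccupiedBelow O i j ∧ (O a ∧ allOccupiedBelow O a K)
    below-i = begin
      allOccupiedBelow O i (suc j + K)                          ≡⟨ cong (allOccupiedBelow O i) (sym (+-suc j K)) ⟩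
      allOccupiedBelow O i (j + suc K)                          ≡⟨ allOccupiedBelow-+ O i j (suc K) ⟩
      allOccupiedBelow O i j ∧ allOccupiedBelow O (i ∸ j) (suc K) ≡⟨ cong (λ z → allOccupiedBelow O i j ∧ allOccupiedBelow O z (suc K)) (m+n∸n≡m (suc a) j) ⟩
      allOccupiedBelow O i j ∧ (O a ∧ allOccupiedBelow O a K)    ∎
    reaches-i : reaches O i (candidates 1 n k l a) ≡ (j <ᵇ l) ∧ allOccupiedBelow O i (suc j + K)
    reaches-i rewrite ≢⇒≡ᵇ≡false a i (<⇒≢ a<i) | reaches-++ O i (back 1 a k) (fwd n a l) back≢i | all-back O a k | reaches-fwd O a j l i≤n
                    | below-i | allOccupied≡allOccupiedBelow O (suc a) j = begin
      O a ∧ (allOccupiedBelow O a K ∧ ((j <ᵇ l) ∧ allOccupiedBelow O i j))  ≡⟨ ∧-assoc (O a) _ _ ⟨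
      (O a ∧ allOccupiedBelow O a K) ∧ ((j <ᵇ l) ∧ allOccupiedBelow O i j)  ≡⟨ ∧-comm (O a ∧ allOccupiedBelow O a K) _ ⟩
      ((j <ᵇ l) ∧ allOccupiedBelow O i j) ∧ (O a ∧ allOccupiedBelow O a K)  ≡⟨ ∧-assoc (j <ᵇ l) _ _ ⟩
      (j <ᵇ l) ∧ (allOccupiedBelow O i j ∧ (O a ∧ allOccupiedBelow O a K))  ∎

  -- If the occupied run just below the vacant spot M + 1 has length v, then fromLeft M v
  -- preferences a ≤ M send a car forward into M + 1 (see landsOn-from-left and ∑<-needed).
  fromLeft : ℕ → ℕ → ℕ
  fromLeft M v = if v ≡ᵇ M then M ⊓ l else (v ∸ k) ⊓ l

  needed : ℕ → ℕ → ℕ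
  needed M j = suc j + k ⊓ (M ∸ suc j)

  needed≤ : ∀ M j → j < M → needed M j ≤ M
  needed≤ M j j<M = ≤-trans (+-monoʳ-≤ (suc j) (m⊓n≤n k (M ∸ suc j))) (≤-reflexive (m+[n∸m]≡n j<M))

  needed≤ᵇ : ∀ M v j → j < M → v < M → (needed M j ≤ᵇ v) ≡ (j <ᵇ v ∸ k)
  needed≤ᵇ M v j j<M v<M with suc j + k ≤? v
  ... | yes j+k<v = trans (≤⇒≤ᵇ≡true (needed M j) v (≤-trans (+-monoʳ-≤ (suc j) (m⊓n≤m k (M ∸ suc j))) j+k<v))
                          (sym (<⇒<ᵇ≡true j (v ∸ k) (m+n≤o⇒m≤o∸n (suc j) j+k<v)))
  ... | no j+k≮v = trans (>⇒≤ᵇ≡false (needed M j) v v<needed) (sym (≥⇒<ᵇ≡false j (v ∸ k) v∸k≤j))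
    where
    v<needed : v < needed M j
    v<needed with k ≤? (M ∸ suc j)
    ... | yes k≤ = subst (v <_) (cong (suc j +_) (sym (m≤n⇒m⊓n≡m k≤))) (≰⇒> j+k≮v)
    ... | no k≰ = subst (v <_) (trans (sym (m+[n∸m]≡n j<M)) (cong (suc j +_) (sym (m≥n⇒m⊓n≡n (<⇒≤ (≰⇒> k≰)))))) v<M
    v∸k≤j : v ∸ k ≤ j
    v∸k≤j = ≤-trans (∸-monoˡ-≤ k (≤-pred (≰⇒> j+k≮v))) (≤-reflexive (m+n∸n≡m j k))

  ∑<-needed : ∀ M v → v ≤ M → ∑< M (λ j → χ (j <ᵇ l) * χ (needed M j ≤ᵇ v)) ≡ fromLeft M v
  ∑<-needed M v v≤M with v ≡ᵇ M in v≡ᵇM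
  ... | true rewrite ≡ᵇ≡true⇒≡ v M v≡ᵇM = begin
    ∑< M (λ j → χ (j <ᵇ l) * χ (needed M j ≤ᵇ M))  ≡⟨ ∑<-cong< M (λ j j<M → cong (λ b → χ (j <ᵇ l) * χ b) (all-needed j j<M)) ⟩
    ∑< M (λ j → χ (j <ᵇ l) * χ (j <ᵇ M))           ≡⟨ ∑<-χ<*χ< M l M ≤-refl ⟩
    l ⊓ M                                          ≡⟨ ⊓-comm l M ⟩
    M ⊓ l                                          ∎
    where
    all-needed : ∀ j → j < M → (needed M j ≤ᵇ M) ≡ (j <ᵇ M)
    all-needed j j<M = trans (≤⇒≤ᵇ≡true (needed M j) M (needed≤ M j j<M)) (sym (<⇒<ᵇ≡true j M j<M))
  ... | false = begin
    ∑< M (λ j → χ (j <ᵇ l) * χ (needed M j ≤ᵇ v))  ≡⟨ ∑<-cong< M (λ j j<M → cong (λ b → χ (j <ᵇ l) * χ b) (needed≤ᵇ M v j j<M v<M)) ⟩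
    ∑< M (λ j → χ (j <ᵇ l) * χ (j <ᵇ v ∸ k))       ≡⟨ ∑<-χ<*χ< M l (v ∸ k) (≤-trans (m∸n≤m v k) v≤M) ⟩
    l ⊓ (v ∸ k)                                    ≡⟨ ⊓-comm l (v ∸ k) ⟩
    (v ∸ k) ⊓ l                                    ∎
    where
    v<M : v < M
    v<M = ≤∧≢⇒< v≤M (λ v≡M → true≢false (trans (sym (dec-true (v ≟ M) v≡M)) v≡ᵇM))

  ∑-landsOn : ∀ O M → suc M ≤ n → O (suc M) ≡ false →
    ∑ (spots 1 n) (λ a → landsOn (firstVacant O (candidates 1 n k l a)) (suc M)) ≡
    fromLeft M (run↓ O (suc M) M) + (1 + k ⊓ run↑ O (suc M + 1) (n ∸ suc M))
  ∑-landsOn O M M<n OM = begin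
    ∑ (spots 1 n) f                                              ≡⟨ cong (λ z → ∑ z f) spots-around ⟩
    ∑ (spots 1 M ++ spots (1 + M) (suc N)) f                     ≡⟨ ∑-++ (spots 1 M) _ f ⟩
    ∑ (spots 1 M) f + (f (suc M) + ∑ (spots (suc (suc M)) N) f)  ≡⟨ cong₂ _+_ left (cong₂ _+_ own right) ⟩
    fromLeft M v + (1 + k ⊓ u)                                   ∎
    where
    N = n ∸ suc M
    u = run↑ O (suc M + 1) N
    v = run↓ O (suc M) M
    f : ℕ → ℕ
    f a = landsOn (firstVacant O (candidates 1 n k l a)) (suc M)
    spots-around : spots 1 n ≡ spots 1 M ++ spots (1 + M) (suc N)
    spots-around = trans (cong (spots 1) (sym (trans (+-suc M N) (m+[n∸m]≡n M<n)))) (spots-++ 1 M (suc N))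
    own : f (suc M) ≡ 1
    own rewrite OM | ≡ᵇ-refl M = refl
    right : ∑ (spots (suc (suc M)) N) f ≡ k ⊓ u
    right = begin
      ∑ (spots (suc (suc M)) N) f
        ≡⟨ ∑-spots (suc (suc M)) N f ⟩
      ∑< N (λ j → f (suc (suc M) + j))
        ≡⟨ ∑<-cong< N (λ j _ → trans (cong (λ z → f (z + j)) (+-comm 1 (suc M))) (landsOn-from-right O (suc M) j (s≤s z≤n) OM)) ⟩
      ∑< N (λ j → χ (j <ᵇ k) * χ (allOccupied O (suc M + 1) (suc j)))
        ≡⟨ ∑<-cong< N (λ j j<N → cong (λ z → χ (j <ᵇ k) * χ z) (allOccupied≡≤ᵇrun↑ O (suc M + 1) N (suc j) j<N)) ⟩
      ∑< N (λ j → χ (j <ᵇ k) * χ (j <ᵇ u))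
        ≡⟨ ∑<-χ<*χ< N k u (run↑-≤ O (suc M + 1) N) ⟩
      k ⊓ u ∎
    from-M∸j : ∀ j → j < M → f (M ∸ j) ≡ χ (j <ᵇ l) * χ (needed M j ≤ᵇ v)
    from-M∸j j j<M = begin
      f (M ∸ j)
        ≡⟨ landsOn-from-left O (M ∸ j) j M (m∸n+n≡m (<⇒≤ j<M)) (m<n⇒0<n∸m j<M) M<n OM ⟩
      χ (j <ᵇ l) * χ (allOccupiedBelow O (suc M) (suc j + k ⊓ (M ∸ j ∸ 1)))
        ≡⟨ cong (λ d → χ (j <ᵇ l) * χ (allOccupiedBelow O (suc M) (suc j + k ⊓ d))) (trans (∸-+-assoc M j 1) (cong (M ∸_) (+-comm j 1))) ⟩
      χ (j <ᵇ l) * χ (allOccupiedBelow O (suc M) (needed M j))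
        ≡⟨ cong (λ z → χ (j <ᵇ l) * χ z) (allOccupiedBelow≡≤ᵇrun↓ O (suc M) M (needed M j) (needed≤ M j j<M)) ⟩
      χ (j <ᵇ l) * χ (needed M j ≤ᵇ v) ∎
    left : ∑ (spots 1 M) f ≡ fromLeft M v
    left = begin
      ∑ (spots 1 M) f                                ≡⟨ ∑-spots 1 M f ⟩
      ∑< M (λ j → f (suc j))                         ≡⟨ ∑<-reverse M f ⟩
      ∑< M (λ j → f (M ∸ j))                         ≡⟨ ∑<-cong< M from-M∸j ⟩
      ∑< M (λ j → χ (j <ᵇ l) * χ (needed M j ≤ᵇ v))  ≡⟨ ∑<-needed M v (run↓-≤ O (suc M) M) ⟩
      fromLeft M v                                   ∎

-- Conditioning on the spot of the last car

parkWeight-snoc : ∀ c T O w a →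
  parkWeight c T O (w ++ [ a ]) ≡ weight (λ O′ → weight T (park′ c [] (firstVacant O′ (c a)) O′)) (park c O w)
parkWeight-snoc c T O [] a = refl
parkWeight-snoc c T O (x ∷ w) a with firstVacant O (c x)
... | nothing = refl
... | just s = parkWeight-snoc c T (occupy O s) w a

weight-park′-[] : ∀ c ms O → weight (λ _ → 1) (park′ c [] ms O) ≡ χ (isJust ms)
weight-park′-[] c nothing O = refl
weight-park′-[] c (just s) O = refl

∑-weight : ∀ {X : Set} (xs : List X) (g : X → Occupancy → ℕ) r → ∑ xs (λ a → weight (g a) r) ≡ weight (λ O → ∑ xs (λ a → g a O)) r
∑-weight xs g nothing = ∑-zero xs
∑-weight xs g (just O) = refl

∑-spots-≢ : ∀ t c s → s < t → ∑ (spots t c) (λ i → χ (s ≡ᵇ i)) ≡ 0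
∑-spots-≢ t zero s _ = refl
∑-spots-≢ t (suc c) s s<t rewrite ≢⇒≡ᵇ≡false s t (<⇒≢ s<t) = ∑-spots-≢ (suc t) c s (m<n⇒m<1+n s<t)

∑-spots-δ : ∀ t c s → t ≤ s → s < t + c → ∑ (spots t c) (λ i → χ (s ≡ᵇ i)) ≡ 1
∑-spots-δ t zero s t≤s s<t+0 = ⊥-elim (<⇒≱ s<t+0 (subst (_≤ s) (sym (+-identityʳ t)) t≤s))
∑-spots-δ t (suc c) s t≤s s<t+c with s ≟ t
... | yes refl rewrite ≡ᵇ-refl s = cong suc (∑-spots-≢ (suc s) c s ≤-refl)
... | no s≢t rewrite ≢⇒≡ᵇ≡false s t s≢t = ∑-spots-δ (suc t) c s (≤∧≢⇒< t≤s (s≢t ∘ sym)) (subst (s <_) (+-suc t c) s<t+c)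

module _ (k l : ℕ) where
  ∑park-+ : ∀ lo b j (T T′ : Occupancy → ℕ) → ∑park k l lo b j (λ O → T O + T′ O) ≡ ∑park k l lo b j T + ∑park k l lo b j T′
  ∑park-+ lo b j T T′ = trans (∑words-cong j _ (λ w → weight-+ (park (candidates lo b k l) ∅ w))) (∑-+ (words j _) _ _)
    where
    weight-+ : ∀ r → weight (λ O → T O + T′ O) r ≡ weight T r + weight T′ r
    weight-+ nothing = refl
    weight-+ (just O) = refl

  ∑park-*ˡ : ∀ lo b j c (T : Occupancy → ℕ) → ∑park k l lo b j (λ O → c * T O) ≡ c * ∑park k l lo b j T
  ∑park-*ˡ lo b j c T = trans (∑words-cong j _ (λ w → weight-*ˡ (park (candidates lo b k l) ∅ w))) (∑-*ˡ (words j _) c _)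
    where
    weight-*ˡ : ∀ r → weight (λ O → c * T O) r ≡ c * weight T r
    weight-*ˡ nothing = sym (*-zeroʳ c)
    weight-*ˡ (just O) = refl

  ∑park-∑< : ∀ lo b j N (F : ℕ → Occupancy → ℕ) → ∑park k l lo b j (λ O → ∑< N (λ R → F R O)) ≡ ∑< N (λ R → ∑park k l lo b j (F R))
  ∑park-∑< lo b j N F = trans (∑words-cong j _ (λ w → weight-∑< (park (candidates lo b k l) ∅ w))) (∑-∑<-swap (words j _) N _)
    where
    weight-∑< : ∀ r → weight (λ O → ∑< N (λ R → F R O)) r ≡ ∑< N (λ R → weight (F R) r)
    weight-∑< nothing = sym (∑<-zero N)
    weight-∑< (just O) = refl

  module LastCar (n : ℕ) where
    arrivals : ℕ → Occupancy → ℕ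
    arrivals i O = ∑ (spots 1 n) (λ a → landsOn (firstVacant O (candidates 1 n k l a)) i)

    parks≡∑landsOn : ∀ O a → 1 ≤ a → a ≤ n →
      χ (isJust (firstVacant O (candidates 1 n k l a))) ≡ ∑ (spots 1 n) (λ i → landsOn (firstVacant O (candidates 1 n k l a)) i)
    parks≡∑landsOn O a 1≤a a≤n with firstVacant O (candidates 1 n k l a) in eq
    ... | nothing = sym (∑-zero (spots 1 n))
    ... | just s = sym (∑-spots-δ 1 n s (proj₁ s-in) (s≤s (proj₂ s-in)))
      where
      s-in = firstVacant-All O (candidates 1 n k l a) (candidates-within k l 1 n a 1≤a a≤n) eq

    ∑parks≡∑arrivals : ∀ O → ∑ (spots 1 n) (λ a → χ (isJust (firstVacant O (candidates 1 n k l a)))) ≡ ∑ (spots 1 n) (λ i → ifVacant i (arrivals i) O)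
    ∑parks≡∑arrivals O = begin
      ∑ (spots 1 n) (λ a → χ (isJust (firstVacant O (candidates 1 n k l a))))
        ≡⟨ ∑-congAll (All.map (λ a-in → parks≡∑landsOn O _ (proj₁ a-in) (proj₂ a-in)) (spots-within k l 1 n ≤-refl)) ⟩
      ∑ (spots 1 n) (λ a → ∑ (spots 1 n) (λ i → landsOn (firstVacant O (candidates 1 n k l a)) i))
        ≡⟨ ∑-swap (spots 1 n) (spots 1 n) _ ⟩
      ∑ (spots 1 n) (λ i → arrivals i O)
        ≡⟨ ∑-cong (spots 1 n) arrivals-only-if-vacant ⟩
      ∑ (spots 1 n) (λ i → ifVacant i (arrivals i) O) ∎
      where
      arrivals-only-if-vacant : ∀ i → arrivals i O ≡ ifVacant i (arrivals i) O
      arrivals-only-if-vacant i with O i in Oi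
      ... | false = refl
      ... | true = trans (∑-cong (spots 1 n) (λ a → landsOn-occupied O i (candidates 1 n k l a) Oi)) (∑-zero (spots 1 n))

    numPF-lastCar : ∀ m′ → numPF k l (suc m′) n ≡ ∑ (spots 1 n) (λ i → ∑park k l 1 n m′ (ifVacant i (arrivals i)))
    numPF-lastCar m′ = begin
      numPF k l (suc m′) n
        ≡⟨ numPF≡∑park k l (suc m′) n ⟩
      ∑words (suc m′) A (parkWeight c (λ _ → 1) ∅)
        ≡⟨ ∑words-snoc m′ A _ ⟩
      ∑words m′ A (λ w → ∑ A (λ a → parkWeight c (λ _ → 1) ∅ (w ++ [ a ])))
        ≡⟨ ∑words-cong m′ A (λ w → ∑-cong A (λ a → parkWeight-snoc c (λ _ → 1) ∅ w a)) ⟩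
      ∑words m′ A (λ w → ∑ A (λ a → weight (lastParks a) (park c ∅ w)))
        ≡⟨ ∑words-cong m′ A (λ w → ∑-weight A lastParks (park c ∅ w)) ⟩
      ∑words m′ A (λ w → weight (λ O → ∑ A (λ a → lastParks a O)) (park c ∅ w))
        ≡⟨ ∑words-cong m′ A (λ w → weight-cong (λ O → trans (∑-cong A (λ a → weight-park′-[] c (firstVacant O (c a)) O)) (∑parks≡∑arrivals O)) (park c ∅ w)) ⟩
      ∑words m′ A (λ w → weight (λ O → ∑ A (λ i → ifVacant i (arrivals i) O)) (park c ∅ w))
        ≡⟨ ∑words-cong m′ A (λ w → ∑-weight A (λ i → ifVacant i (arrivals i)) (park c ∅ w)) ⟨
      ∑words m′ A (λ w → ∑ A (λ i → weight (ifVacant i (arrivals i)) (park c ∅ w)))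
        ≡⟨ ∑-swap (words m′ A) A _ ⟩
      ∑ A (λ i → ∑park k l 1 n m′ (ifVacant i (arrivals i))) ∎
      where
      A = spots 1 n
      c = candidates 1 n k l
      lastParks : ℕ → Occupancy → ℕ
      lastParks a O = weight (λ _ → 1) (park′ c [] (firstVacant O (c a)) O)

χ-ifVacant-swap : ∀ (x y d : Bool) → (if x then 0 else χ (d ∧ not y)) ≡ (if y then 0 else χ d * χ (not x))
χ-ifVacant-swap true true d = refl
χ-ifVacant-swap true false d = sym (*-zeroʳ (χ d))
χ-ifVacant-swap false true true = refl
χ-ifVacant-swap false true false = refl
χ-ifVacant-swap false false true = refl
χ-ifVacant-swap false false false = refl

module Spot (k l n m′ M : ℕ) (M<n : suc M ≤ n) where
  open LastCar k l n

  i N : ℕ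
  i = suc M
  N = n ∸ suc M

  ∑outcomes : (Occupancy → ℕ) → ℕ
  ∑outcomes = ∑park k l 1 n m′

  vacant : Occupancy → ℕ
  vacant = ifVacant i (λ _ → 1)

  leftRun rightRun : ℕ → Occupancy → ℕ
  leftRun L = ifVacant i (λ O → χ (run↓ O i M ≡ᵇ L))
  rightRun R = ifVacant i (λ O → χ (run↑ O (i + 1) N ≡ᵇ R))

  arrivals-by-runs : ∀ O → ifVacant i (arrivals i) O ≡
    ∑< (suc M) (λ L → fromLeft k l n M L * leftRun L O) + (vacant O + ∑< (suc N) (λ R → (k ⊓ R) * rightRun R O))
  arrivals-by-runs O with O i in Oi
  ... | true = sym (cong₂ _+_ (trans (∑<-cong (suc M) (λ L → *-zeroʳ (fromLeft k l n M L))) (∑<-zero (suc M)))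
                              (trans (∑<-cong (suc N) (λ R → *-zeroʳ (k ⊓ R))) (∑<-zero (suc N))))
  ... | false = trans (∑-landsOn k l n O M M<n Oi)
    (cong₂ _+_ (sym (∑<-δ (suc M) (run↓ O i M) (fromLeft k l n M) (s≤s (run↓-≤ O i M))))
               (cong (1 +_) (sym (∑<-δ (suc N) (run↑ O (i + 1) N) (k ⊓_) (s≤s (run↑-≤ O (i + 1) N))))))

  ∑outcomes-arrivals : ∑outcomes (ifVacant i (arrivals i)) ≡
    ∑< (suc M) (λ L → fromLeft k l n M L * ∑outcomes (leftRun L)) + (∑outcomes vacant + ∑< (suc N) (λ R → (k ⊓ R) * ∑outcomes (rightRun R)))
  ∑outcomes-arrivals = begin
    ∑outcomes (ifVacant i (arrivals i))
      ≡⟨ ∑park-cong k l 1 n m′ arrivals-by-runs ⟩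
    ∑outcomes (λ O → byLeft O + (vacant O + byRight O))
      ≡⟨ ∑park-+ k l 1 n m′ byLeft _ ⟩
    ∑outcomes byLeft + ∑outcomes (λ O → vacant O + byRight O)
      ≡⟨ cong (∑outcomes byLeft +_) (∑park-+ k l 1 n m′ vacant byRight) ⟩
    ∑outcomes byLeft + (∑outcomes vacant + ∑outcomes byRight)
      ≡⟨ cong₂ (λ x y → x + (∑outcomes vacant + y))
           (trans (∑park-∑< k l 1 n m′ (suc M) (λ L O → fromLeft k l n M L * leftRun L O)) (∑<-cong (suc M) (λ L → ∑park-*ˡ k l 1 n m′ (fromLeft k l n M L) (leftRun L))))
           (trans (∑park-∑< k l 1 n m′ (suc N) (λ R O → (k ⊓ R) * rightRun R O)) (∑<-cong (suc N) (λ R → ∑park-*ˡ k l 1 n m′ (k ⊓ R) (rightRun R)))) ⟩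
    ∑< (suc M) (λ L → fromLeft k l n M L * ∑outcomes (leftRun L)) + (∑outcomes vacant + ∑< (suc N) (λ R → (k ⊓ R) * ∑outcomes (rightRun R))) ∎
    where
    byLeft byRight : Occupancy → ℕ
    byLeft O = ∑< (suc M) (λ L → fromLeft k l n M L * leftRun L O)
    byRight O = ∑< (suc N) (λ R → (k ⊓ R) * rightRun R O)

  vacant≡ : ∑outcomes vacant ≡ shuffle m′ (λ x → numPF k l x M) (λ y → numC k l y N)
  vacant≡ = ∑park-vacant-Z k l n i m′ (s≤s z≤n) M<n

  rightRun≡ : ∀ R → R < N →
    ∑outcomes (rightRun R) ≡ shuffle m′ (λ x → numPF k l x M) (λ y → (y C R) * numC k l R R * numC k l (y ∸ R) (N ∸ suc R))
  rightRun≡ R R<N = trans (∑park-cong k l 1 n m′ run-is-R) (∑park-vacant-V k l n i R m′ (s≤s z≤n) i+R<n)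
    where
    run-is-R : ∀ O → rightRun R O ≡ ifVacant i (λ O → χ (allOccupied O (i + 1) R) * χ (not (O (i + suc R)))) O
    run-is-R O with O i
    ... | true = refl
    ... | false = begin
      χ (run↑ O (i + 1) N ≡ᵇ R)                                ≡⟨ cong χ (run↑≡ᵇ O (i + 1) N R R<N) ⟩
      χ (allOccupied O (i + 1) R ∧ not (O (i + 1 + R)))         ≡⟨ χ-∧ (allOccupied O (i + 1) R) _ ⟩
      χ (allOccupied O (i + 1) R) * χ (not (O (i + 1 + R)))     ≡⟨ cong (λ z → χ (allOccupied O (i + 1) R) * χ (not (O z))) (+-assoc i 1 R) ⟩
      χ (allOccupied O (i + 1) R) * χ (not (O (i + suc R)))     ∎
    i+R<n : i + suc R ≤ n
    i+R<n = ≤-trans (+-monoʳ-≤ i R<N) (≤-reflexive (m+[n∸m]≡n M<n))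

  rightRun-N≡ : ∑outcomes (rightRun N) ≡ shuffle m′ (λ x → numPF k l x M) (λ y → if y ≡ᵇ N then numC k l N N else 0)
  rightRun-N≡ = trans (∑park-cong k l 1 n m′ full) (∑park-vacant-X k l n i m′ (s≤s z≤n) M<n)
    where
    full : ∀ O → rightRun N O ≡ ifVacant i (λ O → χ (allOccupied O (i + 1) N)) O
    full O with O i
    ... | true = refl
    ... | false = cong χ (run↑≡ᵇmax O (i + 1) N)

  leftRun-M≡ : ∑outcomes (leftRun M) ≡ shuffle m′ (λ x → if x ≡ᵇ M then numPF k l M M else 0) (λ y → numC k l y N)
  leftRun-M≡ = trans (∑park-cong k l 1 n m′ full) (∑park-vacant-Y k l n i m′ (s≤s z≤n) M<n)
    where
    full : ∀ O → leftRun M O ≡ ifVacant i (λ O → χ (allOccupied O 1 M)) O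
    full O with O i
    ... | true = refl
    ... | false = cong χ (trans (run↓≡ᵇmax O i M) (sym (allOccupied≡allOccupiedBelow O 1 M)))

  -- A left run of length L < M is a full block after the vacant spot M - L, followed by the vacant spot i.
  leftRun≡ : ∀ L → L < M → ∑outcomes (leftRun L) ≡
    shuffle m′ (λ x → numPF k l x (M ∸ L ∸ 1)) (λ y → (y C L) * numC k l L L * numC k l (y ∸ L) (n ∸ (M ∸ L) ∸ suc L))
  leftRun≡ L L<M = trans (∑park-cong k l 1 n m′ block-before-i) (∑park-vacant-V k l n e L m′ (m<n⇒0<n∸m L<M) (subst (_≤ n) (sym e+1+L≡i) M<n))
    where
    e = M ∸ L
    e+1+L≡i : e + suc L ≡ i
    e+1+L≡i = trans (+-suc e L) (cong suc (m∸n+n≡m (<⇒≤ L<M)))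
    block-before-i : ∀ O → leftRun L O ≡ ifVacant e (λ O → χ (allOccupied O (e + 1) L) * χ (not (O (e + suc L)))) O
    block-before-i O rewrite run↓≡ᵇ O i M L L<M | allOccupied≡allOccupiedBelow O (e + 1) L | e+1+L≡i | trans (+-assoc e 1 L) e+1+L≡i =
      χ-ifVacant-swap (O i) (O e) (allOccupiedBelow O i L)

open +-*-Solver using (solve; _:+_; _:*_; _:=_; con)

[a+i]∸n≡a∸[n∸i] : ∀ a i n → i ≤ n → (a + i) ∸ n ≡ a ∸ (n ∸ i)
[a+i]∸n≡a∸[n∸i] a i n i≤n = begin
  (a + i) ∸ n              ≡⟨ cong ((a + i) ∸_) (sym (m+[n∸m]≡n i≤n)) ⟩
  (a + i) ∸ (i + (n ∸ i))  ≡⟨ cong (_∸ (i + (n ∸ i))) (+-comm a i) ⟩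
  (i + a) ∸ (i + (n ∸ i))  ≡⟨ [m+n]∸[m+o]≡n∸o i a (n ∸ i) ⟩
  a ∸ (n ∸ i)              ∎

n∸R∸i∸1≡n∸i∸[1+R] : ∀ n R i → n ∸ R ∸ i ∸ 1 ≡ n ∸ i ∸ suc R
n∸R∸i∸1≡n∸i∸[1+R] n R i = begin
  n ∸ R ∸ i ∸ 1    ≡⟨ cong (_∸ 1) (∸-+-assoc n R i) ⟩
  n ∸ (R + i) ∸ 1  ≡⟨ ∸-+-assoc n (R + i) 1 ⟩
  n ∸ (R + i + 1)  ≡⟨ cong (n ∸_) (solve 2 (λ R i → R :+ i :+ con 1 := i :+ (con 1 :+ R)) refl R i) ⟩
  n ∸ (i + suc R)  ≡⟨ ∸-+-assoc n i (suc R) ⟨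
  n ∸ i ∸ suc R    ∎

n∸[M∸L]∸[1+L]≡n∸[1+M] : ∀ n M L → L ≤ M → n ∸ (M ∸ L) ∸ suc L ≡ n ∸ suc M
n∸[M∸L]∸[1+L]≡n∸[1+M] n M L L≤M = trans (∸-+-assoc n (M ∸ L) (suc L)) (cong (n ∸_) (trans (+-suc (M ∸ L) L) (cong suc (m∸n+n≡m L≤M))))

∑<-drop-prefix : ∀ M k (h : ℕ → ℕ) → (∀ L → L < M → L ≤ k → h L ≡ 0) → ∑< M h ≡ ∑< (M ∸ (k + 1)) (λ j → h (k + 1 + j))
∑<-drop-prefix M k h h≡0 with k + 1 ≤? M
... | yes k<M = begin
  ∑< M h                                                  ≡⟨ cong (λ q → ∑< q h) (sym (m+[n∸m]≡n k<M)) ⟩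
  ∑< (k + 1 + (M ∸ (k + 1))) h                            ≡⟨ ∑<-split (k + 1) (M ∸ (k + 1)) h ⟩
  ∑< (k + 1) h + ∑< (M ∸ (k + 1)) (λ j → h (k + 1 + j))   ≡⟨ cong (_+ ∑< (M ∸ (k + 1)) (λ j → h (k + 1 + j))) (trans (∑<-cong< (k + 1) prefix≡0) (∑<-zero (k + 1))) ⟩
  ∑< (M ∸ (k + 1)) (λ j → h (k + 1 + j))                  ∎
  where
  prefix≡0 : ∀ L → L < k + 1 → h L ≡ 0
  prefix≡0 L L<k+1 = h≡0 L (<-≤-trans L<k+1 k<M) (≤-pred (subst (L <_) (+-comm k 1) L<k+1))
... | no k≮M = begin
  ∑< M h                                   ≡⟨ ∑<-cong< M (λ L L<M → h≡0 L L<M (≤-pred (≤-trans L<M M≤1+k))) ⟩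
  ∑< M (λ _ → 0)                           ≡⟨ ∑<-zero M ⟩
  0                                        ≡⟨ cong (λ q → ∑< q (λ j → h (k + 1 + j))) (m≤n⇒m∸n≡0 (<⇒≤ (≰⇒> k≮M))) ⟨
  ∑< (M ∸ (k + 1)) (λ j → h (k + 1 + j))   ∎
  where
  M≤1+k : M ≤ suc k
  M≤1+k = subst (M ≤_) (+-comm k 1) (<⇒≤ (≰⇒> k≮M))

∑<-init-last : ∀ N (f g : ℕ → ℕ) → g 0 ≡ 0 → (∀ j → suc j < N → f j ≡ g (suc j)) → ∑< (N ∸ 1) f + g N ≡ ∑< N (λ j → g (suc j))
∑<-init-last zero f g g0≡0 _ = g0≡0
∑<-init-last (suc N) f g _ f≡g = begin
  ∑< N f + g (suc N)                   ≡⟨ cong (_+ g (suc N)) (∑<-cong< N (λ j j<N → f≡g j (s≤s j<N))) ⟩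
  ∑< N (λ j → g (suc j)) + g (suc N)   ≡⟨ ∑<-snoc N (λ j → g (suc j)) ⟨
  ∑< (suc N) (λ j → g (suc j))         ∎

∑<-binomial-block : ∀ j R (P Q : ℕ → ℕ) c w →
  ∑< (suc j) (λ x → (j C x) * P x * ((j ∸ x) C R) * c * Q (j ∸ x ∸ R) * w) ≡ w * shuffle j P (λ y → (y C R) * c * Q (y ∸ R))
∑<-binomial-block j R P Q c w = begin
  ∑< (suc j) (λ x → (j C x) * P x * ((j ∸ x) C R) * c * Q (j ∸ x ∸ R) * w)   ≡⟨ ∑<-cong (suc j) (λ x → regroup (j C x) (P x) ((j ∸ x) C R) c (Q (j ∸ x ∸ R)) w) ⟩
  ∑< (suc j) (λ x → w * ((j C x) * P x * H (j ∸ x)))                           ≡⟨ ∑<-*ˡ (suc j) w (λ x → (j C x) * P x * H (j ∸ x)) ⟩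
  w * ∑< (suc j) (λ x → (j C x) * P x * H (j ∸ x))                             ≡⟨ cong (w *_) (shuffle≡binomial j P H) ⟨
  w * shuffle j P H                                                            ∎
  where
  H : ℕ → ℕ
  H y = (y C R) * c * Q (y ∸ R)
  regroup : ∀ a b d e f w → a * b * d * e * f * w ≡ w * (a * b * (d * e * f))
  regroup = solve 6 (λ a b d e f w → a :* b :* d :* e :* f :* w := w :* (a :* b :* (d :* e :* f))) refl

summand : ℕ → ℕ → ℕ → ℕ → ℕ → ℕ
summand m n k l i = X i + Y i + sumFT 0 (m ∸ 1) (λ x → Z i x + sumFT 1 (n ∸ i ∸ 1) (λ R → V i x R) + sumFT (k + 1) (i ∸ 2) (λ R → W i x R))
  where open Terms m n k l

module SpotSummand (k l n m′ M : ℕ) (M<n : suc M ≤ n) where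
  open Spot k l n m′ M M<n
  open Terms (suc m′) n k l using (X; Y; Z; V; W)

  Wcount : ℕ
  Wcount = suc (i ∸ 2) ∸ (k + 1)

  ∑Z ∑V ∑W : ℕ
  ∑Z = ∑< (suc m′) (Z i)
  ∑V = ∑< (N ∸ 1) (λ j → ∑< (suc m′) (λ x → V i x (1 + j)))
  ∑W = ∑< Wcount (λ j → ∑< (suc m′) (λ x → W i x (k + 1 + j)))

  summand-regroup : summand (suc m′) n k l i ≡ X i + Y i + (∑Z + ∑V + ∑W)
  summand-regroup = cong (X i + Y i +_) (begin
    sumFT 0 m′ (λ x → Z i x + sumFT 1 (N ∸ 1) (V i x) + sumFT (k + 1) (i ∸ 2) (W i x))
      ≡⟨ sumFT≡∑< 0 m′ _ ⟩
    ∑< (suc m′) (λ x → Z i x + sumFT 1 (N ∸ 1) (V i x) + sumFT (k + 1) (i ∸ 2) (W i x))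
      ≡⟨ ∑<-cong (suc m′) (λ x → cong₂ (λ p q → Z i x + p + q) (sumFT≡∑< 1 (N ∸ 1) (V i x)) (sumFT≡∑< (k + 1) (i ∸ 2) (W i x))) ⟩
    ∑< (suc m′) (λ x → Z i x + ∑< (N ∸ 1) (λ j → V i x (1 + j)) + ∑< Wcount (λ j → W i x (k + 1 + j)))
      ≡⟨ ∑<-+ (suc m′) (λ x → Z i x + ∑< (N ∸ 1) (λ j → V i x (1 + j))) (λ x → ∑< Wcount (λ j → W i x (k + 1 + j))) ⟩
    ∑< (suc m′) (λ x → Z i x + ∑< (N ∸ 1) (λ j → V i x (1 + j))) + ∑< (suc m′) (λ x → ∑< Wcount (λ j → W i x (k + 1 + j)))
      ≡⟨ cong (_+ ∑< (suc m′) (λ x → ∑< Wcount (λ j → W i x (k + 1 + j)))) (∑<-+ (suc m′) (Z i) (λ x → ∑< (N ∸ 1) (λ j → V i x (1 + j)))) ⟩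
    ∑Z + ∑< (suc m′) (λ x → ∑< (N ∸ 1) (λ j → V i x (1 + j))) + ∑< (suc m′) (λ x → ∑< Wcount (λ j → W i x (k + 1 + j)))
      ≡⟨ cong₂ (λ p q → ∑Z + p + q) (∑<-swap (suc m′) (N ∸ 1) (λ x j → V i x (1 + j))) (∑<-swap (suc m′) Wcount (λ x j → W i x (k + 1 + j))) ⟩
    ∑Z + ∑V + ∑W ∎)

  ∑Z≡ : ∑Z ≡ ∑outcomes vacant
  ∑Z≡ = trans (sym (shuffle≡binomial m′ (λ x → numPF k l x M) (λ y → numC k l y N))) (sym vacant≡)

  ∑V-term≡ : ∀ R → R < N → ∑< (suc m′) (λ x → V i x R) ≡ (k ⊓ R) * ∑outcomes (rightRun R)
  ∑V-term≡ R R<N = begin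
    ∑< (suc m′) (λ x → V i x R)
      ≡⟨ ∑<-cong (suc m′) (λ x → cong (λ z → (m′ C x) * numPF k l x M * ((m′ ∸ x) C R) * numC k l R R * numC k l (m′ ∸ x ∸ R) z * (R ⊓ k))
                                      (n∸R∸i∸1≡n∸i∸[1+R] n R i)) ⟩
    ∑< (suc m′) (λ x → (m′ C x) * numPF k l x M * ((m′ ∸ x) C R) * numC k l R R * numC k l (m′ ∸ x ∸ R) (N ∸ suc R) * (R ⊓ k))
      ≡⟨ ∑<-binomial-block m′ R (λ x → numPF k l x M) (λ y → numC k l y (N ∸ suc R)) (numC k l R R) (R ⊓ k) ⟩
    (R ⊓ k) * shuffle m′ (λ x → numPF k l x M) (λ y → (y C R) * numC k l R R * numC k l (y ∸ R) (N ∸ suc R))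
      ≡⟨ cong₂ _*_ (⊓-comm R k) (sym (rightRun≡ R R<N)) ⟩
    (k ⊓ R) * ∑outcomes (rightRun R) ∎

  X≡ : X i ≡ (k ⊓ N) * ∑outcomes (rightRun N)
  X≡ = begin
    (m′ C N) * numPF k l ((m′ + i) ∸ n) M * numC k l N N * (k ⊓ N)
      ≡⟨ cong (λ z → (m′ C N) * numPF k l z M * numC k l N N * (k ⊓ N)) ([a+i]∸n≡a∸[n∸i] m′ i n M<n) ⟩
    (m′ C N) * numPF k l (m′ ∸ N) M * numC k l N N * (k ⊓ N)
      ≡⟨ solve 4 (λ a b c d → a :* b :* c :* d := d :* (a :* c :* b)) refl (m′ C N) (numPF k l (m′ ∸ N) M) (numC k l N N) (k ⊓ N) ⟩
    (k ⊓ N) * ((m′ C N) * numC k l N N * numPF k l (m′ ∸ N) M)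
      ≡⟨ cong ((k ⊓ N) *_) (shuffle-δˡ m′ N (numC k l N N) (λ x → numPF k l x M)) ⟨
    (k ⊓ N) * shuffle m′ (λ y → if y ≡ᵇ N then numC k l N N else 0) (λ x → numPF k l x M)
      ≡⟨ cong ((k ⊓ N) *_) (trans (shuffle-comm m′ _ _) (sym rightRun-N≡)) ⟩
    (k ⊓ N) * ∑outcomes (rightRun N) ∎

  ∑V+X≡ : ∑V + X i ≡ ∑< N (λ j → (k ⊓ suc j) * ∑outcomes (rightRun (suc j)))
  ∑V+X≡ = begin
    ∑V + X i
      ≡⟨ cong (∑V +_) X≡ ⟩
    ∑< (N ∸ 1) (λ j → ∑< (suc m′) (λ x → V i x (1 + j))) + (k ⊓ N) * ∑outcomes (rightRun N)
      ≡⟨ ∑<-init-last N _ (λ R → (k ⊓ R) * ∑outcomes (rightRun R)) (cong (_* ∑outcomes (rightRun 0)) (⊓-zeroʳ k)) (λ j j<N → ∑V-term≡ (suc j) j<N) ⟩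
    ∑< N (λ j → (k ⊓ suc j) * ∑outcomes (rightRun (suc j))) ∎

  Y≡ : Y i ≡ fromLeft k l n M M * ∑outcomes (leftRun M)
  Y≡ = begin
    (m′ C M) * numPF k l M M * numC k l (m′ ∸ M) N * (M ⊓ l)
      ≡⟨ solve 4 (λ a b c d → a :* b :* c :* d := d :* (a :* b :* c)) refl (m′ C M) (numPF k l M M) (numC k l (m′ ∸ M) N) (M ⊓ l) ⟩
    (M ⊓ l) * ((m′ C M) * numPF k l M M * numC k l (m′ ∸ M) N)
      ≡⟨ cong₂ _*_ fromLeft-M (sym (trans leftRun-M≡ (shuffle-δˡ m′ M (numPF k l M M) (λ y → numC k l y N)))) ⟩
    fromLeft k l n M M * ∑outcomes (leftRun M) ∎
    where
    fromLeft-M : M ⊓ l ≡ fromLeft k l n M M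
    fromLeft-M rewrite ≡ᵇ-refl M = refl

  ∑W-term≡ : ∀ L → L < M → ∑< (suc m′) (λ x → W i x L) ≡ fromLeft k l n M L * ∑outcomes (leftRun L)
  ∑W-term≡ L L<M = begin
    ∑< (suc m′) (λ x → W i x L)
      ≡⟨ ∑<-cong (suc m′) (λ x → cong (λ z → (m′ C x) * numPF k l x z * ((m′ ∸ x) C L) * numC k l L L * numC k l (m′ ∸ x ∸ L) N * ((L ∸ k) ⊓ l))
                                      (cong (_∸ 2) (+-∸-assoc 1 (<⇒≤ L<M)))) ⟩
    ∑< (suc m′) (λ x → (m′ C x) * numPF k l x (M ∸ L ∸ 1) * ((m′ ∸ x) C L) * numC k l L L * numC k l (m′ ∸ x ∸ L) N * ((L ∸ k) ⊓ l))
      ≡⟨ ∑<-binomial-block m′ L (λ x → numPF k l x (M ∸ L ∸ 1)) (λ y → numC k l y N) (numC k l L L) ((L ∸ k) ⊓ l) ⟩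
    ((L ∸ k) ⊓ l) * shuffle m′ (λ x → numPF k l x (M ∸ L ∸ 1)) (λ y → (y C L) * numC k l L L * numC k l (y ∸ L) N)
      ≡⟨ cong₂ _*_ fromLeft-L (sym (trans (leftRun≡ L L<M) (shuffle-cong m′ (λ _ → refl) (λ y → cong (λ z → (y C L) * numC k l L L * numC k l (y ∸ L) z) (n∸[M∸L]∸[1+L]≡n∸[1+M] n M L (<⇒≤ L<M)))))) ⟩
    fromLeft k l n M L * ∑outcomes (leftRun L) ∎
    where
    fromLeft-L : (L ∸ k) ⊓ l ≡ fromLeft k l n M L
    fromLeft-L rewrite ≢⇒≡ᵇ≡false L M (<⇒≢ L<M) = refl

  ∑W≡ : ∑W ≡ ∑< M (λ L → fromLeft k l n M L * ∑outcomes (leftRun L))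
  ∑W≡ = begin
    ∑< Wcount (λ j → ∑< (suc m′) (λ x → W i x (k + 1 + j)))
      ≡⟨ cong (λ z → ∑< z (λ j → ∑< (suc m′) (λ x → W i x (k + 1 + j)))) (Wcount≡ M) ⟩
    ∑< (M ∸ (k + 1)) (λ j → ∑< (suc m′) (λ x → W i x (k + 1 + j)))
      ≡⟨ ∑<-cong< (M ∸ (k + 1)) (λ j j< → ∑W-term≡ (k + 1 + j) (k+1+j<M j j<)) ⟩
    ∑< (M ∸ (k + 1)) (λ j → fromLeft k l n M (k + 1 + j) * ∑outcomes (leftRun (k + 1 + j)))
      ≡⟨ ∑<-drop-prefix M k (λ L → fromLeft k l n M L * ∑outcomes (leftRun L)) no-arrivals ⟨
    ∑< M (λ L → fromLeft k l n M L * ∑outcomes (leftRun L)) ∎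
    where
    Wcount≡ : ∀ M → suc (suc M ∸ 2) ∸ (k + 1) ≡ M ∸ (k + 1)
    Wcount≡ zero = trans (cong (1 ∸_) (+-comm k 1)) (trans (0∸n≡0 k) (sym (0∸n≡0 (k + 1))))
    Wcount≡ (suc M) = refl
    k+1+j<M : ∀ j → j < M ∸ (k + 1) → k + 1 + j < M
    k+1+j<M j j< = subst (k + 1 + j <_) (m+[n∸m]≡n k+1≤M) (+-monoʳ-< (k + 1) j<)
      where
      k+1≤M : k + 1 ≤ M
      k+1≤M = ≮⇒≥ (λ M<k+1 → n≮0 (subst (j <_) (m≤n⇒m∸n≡0 (<⇒≤ M<k+1)) j<))
    no-arrivals : ∀ L → L < M → L ≤ k → fromLeft k l n M L * ∑outcomes (leftRun L) ≡ 0
    no-arrivals L L<M L≤k rewrite ≢⇒≡ᵇ≡false L M (<⇒≢ L<M) | m≤n⇒m∸n≡0 L≤k = refl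

  ∑outcomes-arrivals≡summand : ∑outcomes (ifVacant i (LastCar.arrivals k l n i)) ≡ summand (suc m′) n k l i
  ∑outcomes-arrivals≡summand = begin
    ∑outcomes (ifVacant i (LastCar.arrivals k l n i))
      ≡⟨ ∑outcomes-arrivals ⟩
    ∑< (suc M) (λ L → fromLeft k l n M L * ∑outcomes (leftRun L)) + (∑outcomes vacant + ∑< (suc N) (λ R → (k ⊓ R) * ∑outcomes (rightRun R)))
      ≡⟨ cong₂ (λ p q → p + (∑outcomes vacant + q)) (∑<-snoc M (λ L → fromLeft k l n M L * ∑outcomes (leftRun L)))
                                                   (cong (_+ ∑< N (λ j → (k ⊓ suc j) * ∑outcomes (rightRun (suc j)))) (cong (_* ∑outcomes (rightRun 0)) (⊓-zeroʳ k))) ⟩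
    (∑< M (λ L → fromLeft k l n M L * ∑outcomes (leftRun L)) + fromLeft k l n M M * ∑outcomes (leftRun M))
      + (∑outcomes vacant + ∑< N (λ j → (k ⊓ suc j) * ∑outcomes (rightRun (suc j))))
      ≡⟨ cong₂ _+_ (cong₂ _+_ (sym ∑W≡) (sym Y≡)) (cong₂ _+_ (sym ∑Z≡) (sym ∑V+X≡)) ⟩
    (∑W + Y i) + (∑Z + (∑V + X i))
      ≡⟨ solve 5 (λ a b c d e → (a :+ b) :+ (c :+ (d :+ e)) := e :+ b :+ (c :+ d :+ a)) refl ∑W (Y i) ∑Z ∑V (X i) ⟩
    X i + Y i + (∑Z + ∑V + ∑W)
      ≡⟨ summand-regroup ⟨
    summand (suc m′) n k l i ∎

theorem3p14 : (m n k l : ℕ) → 0 < m → m ≤ n → k ≤ n ∸ 1 → l ≤ n ∸ 1 →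
    numPF k l m n ≡ Terms.RHS m n k l
theorem3p14 (suc m′) n k l _ _ _ _ = begin
  numPF k l (suc m′) n
    ≡⟨ LastCar.numPF-lastCar k l n m′ ⟩
  ∑ (spots 1 n) (λ i → ∑park k l 1 n m′ (ifVacant i (LastCar.arrivals k l n i)))
    ≡⟨ ∑-spots 1 n _ ⟩
  ∑< n (λ M → ∑park k l 1 n m′ (ifVacant (suc M) (LastCar.arrivals k l n (suc M))))
    ≡⟨ ∑<-cong< n (SpotSummand.∑outcomes-arrivals≡summand k l n m′) ⟩
  ∑< n (λ M → summand (suc m′) n k l (suc M))
    ≡⟨ sumFT≡∑< 1 n (summand (suc m′) n k l) ⟨
  Terms.RHS (suc m′) n k l ∎
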